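{- For every positive integer $n$ with $n\equiv 0 \pmod 4$, there is a planar graph $G$ of order $n$ such that $\mathrm{conv}^{\leq 3}(G) \geq \frac{7n}{6} - 2$.
   Context: In an oriented graph, the inversion of a vertex set $X$ reverses the orientation of every arc with both endvertices in $X$; a $(\leq 3)$-inversion is the inversion of a set of at most $3$ vertices. For a graph $G$, $\mathrm{conv}^{\leq 3}(G)$ is the minimum number of $(\leq 3)$-inversions transforming an orientation of $G$ into its converse (all arcs reversed); this does not depend on the chosen orientation. -}

module Defs where

open import Data.Nat as ℕ using (ℕ; _≤_)
open import Data.Fin using (Fin)
open import Data.Bool using (Bool; true; false; _∧_; _xor_; if_then_else_)
open import Data.Fin.Subset using (Subset; ∣_∣)
open import Data.Vec using (lookup)
open import Data.List using (List; foldl)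
open import Data.List.Relation.Unary.All using (All)
open import Data.Integer as ℤ using (ℤ; _-_; _*_; _<_; _≤_; 0ℤ)
open import Data.Product using (_×_; _,_; proj₁; proj₂; Σ)
open import Relation.Binary.PropositionalEquality using (_≡_)
open import Relation.Nullary using (¬_)
open import Function.Definitions using (Injective)

record Graph (n : ℕ) : Set where
  field
    adj    : Fin n → Fin n → Bool
    sym    : ∀ u v → adj u v ≡ adj v u
    irrefl : ∀ u → adj u u ≡ false
open Graph public

-- Oriented graphs: o u v ≡ true means there is an arc u → v.

Orient : ℕ → Set
Orient n = Fin n → Fin n → Bool

IsOrientation : ∀ {n} → Graph n → Orient n → Set
IsOrientation G o =
  (∀ u v → o u v ≡ true → adj G u v ≡ true) ×
  (∀ u v → adj G u v ≡ true → (o u v xor o v u) ≡ true)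

invert : ∀ {n} → Subset n → Orient n → Orient n
invert X o u v = if (lookup X u ∧ lookup X v) then o v u else o u v

invertAll : ∀ {n} → List (Subset n) → Orient n → Orient n
invertAll Xs o = foldl (λ d X → invert X d) o Xs

ConvSeq≤3 : ∀ {n} → Orient n → List (Subset n) → Set
ConvSeq≤3 o Xs =
  All (λ X → ∣ X ∣ ℕ.≤ 3) Xs ×
  (∀ u v → invertAll Xs o u v ≡ o v u)

-- Planarity, via straight-line drawings with integer coordinates
-- (equivalent to planarity by Fáry's theorem).

Point : Set
Point = ℤ × ℤ

orient : Point → Point → Point → ℤ
orient (px , py) (qx , qy) (rx , ry) =
  ((qx - px) * (ry - py)) - ((qy - py) * (rx - px))

-- r lies on the closed segment [p , q]
OnSegment : Point → Point → Point → Set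
OnSegment p q r =
  orient p q r ≡ 0ℤ ×
  ((proj₁ r - proj₁ p) * (proj₁ r - proj₁ q) ℤ.≤ 0ℤ) ×
  ((proj₂ r - proj₂ p) * (proj₂ r - proj₂ q) ℤ.≤ 0ℤ)

ProperCross : Point → Point → Point → Point → Set
ProperCross a b c d =
  (orient a b c * orient a b d < 0ℤ) × (orient c d a * orient c d b < 0ℤ)

-- A straight-line plane drawing of G: distinct vertices get distinct
-- points, no vertex lies on an edge not incident to it, and no two
-- edges cross.  (Together these say that edges meet only at common
-- endpoints.)
IsPlaneDrawing : ∀ {n} → Graph n → (Fin n → Point) → Set
IsPlaneDrawing {n} G pos =
  Injective _≡_ _≡_ pos ×
  (∀ u v w → adj G u v ≡ true → ¬ (w ≡ u) → ¬ (w ≡ v) →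
     ¬ OnSegment (pos u) (pos v) (pos w)) ×
  (∀ a b c d → adj G a b ≡ true → adj G c d ≡ true →
     ¬ ProperCross (pos a) (pos b) (pos c) (pos d))

Planar : ∀ {n} → Graph n → Set
Planar {n} G = Σ (Fin n → Point) (IsPlaneDrawing G)

{-# OPTIONS --safe #-}
-- Fix an orientation o of G and measure any other orientation d by the potential
-- Σ_v ⌈m(v)/2⌉, where m(v) counts the arcs into v on which d and o disagree.
-- Inverting a set X changes m(v) only for v ∈ X, and by at most |X| - 1, so a
-- (≤ 3)-inversion raises the potential by at most 3.  The potential is 0 at o and
-- Σ_v ⌈deg v/2⌉ at the converse of o, hence conv≤3(G) ≥ Σ_v ⌈deg v/2⌉ / 3.
--
-- For n = 4k + 4 take two rows up 0 … up q and lo 0 … lo q (q = 2k), joined into a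
-- triangulated strip, plus two poles: top sees the upper row and lo q, bot sees the
-- lower row and up 0, and top sees bot.  This is a triangulation whose degrees are
-- all odd (5, except 3 at up q and lo 0, and q + 3 at the poles), so
-- Σ_v ⌈deg v/2⌉ = (7n - 12)/2.  Planarity is certified by an explicit drawing with
-- natural coordinates in which every pair of edges, and every edge and vertex off
-- it, is separated by an explicit line.
module Submission where

open import Defs hiding (sym)

-- Plane geometry over ℤ

module Geometry where

  open import Data.Integer.Base
    using (ℤ; 0ℤ; +0; +[1+_]; -[1+_]; +≤+; _*_; _+_; _-_; -_; _≤_; _<_; nonNegative; positive)
  import Data.Integer.Properties as ℤ
  import Data.Integer.Tactic.RingSolver as ℤ-Solver
  open import Data.List using ([]; _∷_)
  open import Data.Nat.Base using (z≤n)
  open import Data.Product using (_,_)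
  open import Relation.Binary.PropositionalEquality
  open import Relation.Nullary using (¬_)

  private variable
    i j A B C a c : ℤ

  i<j⇒i-j<0 : i < j → i - j < 0ℤ
  i<j⇒i-j<0 {i} {j} i<j = subst (i - j <_) (ℤ.+-inverseʳ j) (ℤ.+-monoˡ-< (- j) i<j)

  0≤i*i : ∀ i → 0ℤ ≤ i * i
  0≤i*i +0        = +≤+ z≤n
  0≤i*i +[1+ n ]  = +≤+ z≤n
  0≤i*i -[1+ n ]  = +≤+ z≤n

  i*i≤0⇒i≡0 : i * i ≤ 0ℤ → i ≡ 0ℤ
  i*i≤0⇒i≡0 {+0}        _        = refl
  i*i≤0⇒i≡0 {+[1+ n ]}  (+≤+ ())
  i*i≤0⇒i≡0 { -[1+ n ]} (+≤+ ())

  *-nonNeg : 0ℤ ≤ i → 0ℤ ≤ j → 0ℤ ≤ i * j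
  *-nonNeg {i} 0≤i 0≤j =
    subst (_≤ i * _) (ℤ.*-zeroʳ i) (ℤ.*-monoˡ-≤-nonNeg i {{nonNegative 0≤i}} 0≤j)

  *-nonNeg-nonPos : 0ℤ ≤ i → j ≤ 0ℤ → i * j ≤ 0ℤ
  *-nonNeg-nonPos {i} 0≤i j≤0 =
    subst (i * _ ≤_) (ℤ.*-zeroʳ i) (ℤ.*-monoˡ-≤-nonNeg i {{nonNegative 0≤i}} j≤0)

  *-pos-neg : 0ℤ < i → j < 0ℤ → i * j < 0ℤ
  *-pos-neg {i} 0<i j<0 =
    subst (i * _ <_) (ℤ.*-zeroʳ i) (ℤ.*-monoˡ-<-pos i {{positive 0<i}} j<0)

  neg*nonNeg⇒nonPos : i < 0ℤ → 0ℤ ≤ i * j → j ≤ 0ℤ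
  neg*nonNeg⇒nonPos {i} {j} i<0 0≤ij = ℤ.≮⇒≥ λ 0<j →
    ℤ.<-irrefl refl (ℤ.≤-<-trans 0≤ij (subst (_< 0ℤ) (ℤ.*-comm j i) (*-pos-neg 0<j i<0)))

  -- For x, y of opposite signs, (x B - y A) / (x - y) is a convex combination of A and B.
  convex-combination : ∀ x y A B → (x * B - y * A) * (x - y) ≡ x * x * B + y * y * A + - (x * y) * (A + B)
  convex-combination = ℤ-Solver.solve-∀

  convex-combination-nonNeg : ∀ x y → x * y < 0ℤ → 0ℤ ≤ A → 0ℤ ≤ B → 0ℤ ≤ (x * B - y * A) * (x - y)
  convex-combination-nonNeg {A} {B} x y xy<0 0≤A 0≤B = subst (0ℤ ≤_) (sym (convex-combination x y A B))
    (ℤ.+-mono-≤ (ℤ.+-mono-≤ (*-nonNeg (0≤i*i x) 0≤B) (*-nonNeg (0≤i*i y) 0≤A))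
                (*-nonNeg (ℤ.<⇒≤ (ℤ.neg-mono-< xy<0)) (ℤ.+-mono-≤ 0≤A 0≤B)))

  convex-combination-neg : ∀ x y → x * y < 0ℤ → A < 0ℤ → B < 0ℤ → (x * B - y * A) * (x - y) < 0ℤ
  convex-combination-neg {A} {B} x y xy<0 A<0 B<0 = subst (_< 0ℤ) (sym (convex-combination x y A B))
    (ℤ.+-mono-≤-< (ℤ.+-mono-≤ (*-nonNeg-nonPos (0≤i*i x) (ℤ.<⇒≤ B<0)) (*-nonNeg-nonPos (0≤i*i y) (ℤ.<⇒≤ A<0)))
                  (*-pos-neg (ℤ.neg-mono-< xy<0) (ℤ.+-mono-< A<0 B<0)))

  affine : ℤ → ℤ → ℤ → Point → ℤ
  affine α β γ (x , y) = α * x + β * y + γ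

  -- Both sides are, up to the factors (s - t) and (u - v), the value of the
  -- affine form at the intersection point of the lines ab and cd.
  crossing-identity : ∀ ax ay bx by cx cy dx dy α β γ →
    let ori = λ px py qx qy rx ry → (qx - px) * (ry - py) - (qy - py) * (rx - px)
        ℓ = λ x y → α * x + β * y + γ
        u = ori cx cy dx dy ax ay
        v = ori cx cy dx dy bx by
        s = ori ax ay bx by cx cy
        t = ori ax ay bx by dx dy
    in (u * ℓ bx by - v * ℓ ax ay) * (s - t) ≡ (s * ℓ dx dy - t * ℓ cx cy) * (u - v)
  crossing-identity = ℤ-Solver.solve-∀

  square-transfer : ∀ P p Q r → P * r ≡ Q * p → P * p * (r * r) ≡ Q * r * (p * p)
  square-transfer P p Q r Pr≡Qp = begin
    P * p * (r * r)   ≡⟨ ℤ-Solver.solve (P ∷ p ∷ r ∷ []) ⟩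
    P * r * (p * r)   ≡⟨ cong (_* (p * r)) Pr≡Qp ⟩
    Q * p * (p * r)   ≡⟨ ℤ-Solver.solve (Q ∷ p ∷ r ∷ []) ⟩
    Q * r * (p * p)   ∎
    where open ≡-Reasoning

  -- W (s - t)² = Z (u - v)² with W ≥ 0 > Z forces u = v, contradicting u v < 0.
  separated⇒¬ProperCross : ∀ α β γ {a b c d} →
    0ℤ ≤ affine α β γ a → 0ℤ ≤ affine α β γ b → affine α β γ c < 0ℤ → affine α β γ d < 0ℤ →
    ¬ ProperCross a b c d
  separated⇒¬ProperCross α β γ {a@(ax , ay)} {b@(bx , by)} {c@(cx , cy)} {d@(dx , dy)} 0≤ℓa 0≤ℓb ℓc<0 ℓd<0 (st<0 , uv<0) =
    ℤ.<-irrefl refl (ℤ.≤-<-trans (0≤i*i u) (subst (_< 0ℤ) (cong (u *_) (sym u≡v)) uv<0))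
    where
    ℓ : Point → ℤ
    ℓ = affine α β γ
    u v s t : ℤ
    u = orient c d a
    v = orient c d b
    s = orient a b c
    t = orient a b d
    W≥0 : 0ℤ ≤ (u * ℓ b - v * ℓ a) * (u - v)
    W≥0 = convex-combination-nonNeg u v uv<0 0≤ℓa 0≤ℓb
    Z<0 : (s * ℓ d - t * ℓ c) * (s - t) < 0ℤ
    Z<0 = convex-combination-neg s t st<0 ℓc<0 ℓd<0
    u≡v : u ≡ v
    u≡v = ℤ.i-j≡0⇒i≡j u v (i*i≤0⇒i≡0 (neg*nonNeg⇒nonPos Z<0
      (subst (0ℤ ≤_) (square-transfer (u * ℓ b - v * ℓ a) (u - v) (s * ℓ d - t * ℓ c) (s - t) (crossing-identity ax ay bx by cx cy dx dy α β γ))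
        (*-nonNeg W≥0 (0≤i*i (s - t))))))

  interpolation-x : ∀ px py qx qy wx wy α β γ →
    let o = (qx - px) * (wy - py) - (qy - py) * (wx - px)
        ℓ = λ x y → α * x + β * y + γ
    in ℓ wx wy * ((wx - px) - (wx - qx)) ≡ ℓ px py * (- (wx - qx)) + ℓ qx qy * (wx - px) + β * o
  interpolation-x = ℤ-Solver.solve-∀

  interpolation-y : ∀ px py qx qy wx wy α β γ →
    let o = (qx - px) * (wy - py) - (qy - py) * (wx - px)
        ℓ = λ x y → α * x + β * y + γ
    in ℓ wx wy * ((wy - py) - (wy - qy)) ≡ ℓ px py * (- (wy - qy)) + ℓ qx qy * (wy - py) + (- α) * o
  interpolation-y = ℤ-Solver.solve-∀

  +-*-zero : ∀ x k {o} → o ≡ 0ℤ → x + k * o ≡ x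
  +-*-zero x k refl = trans (cong (x +_) (ℤ.*-zeroʳ k)) (ℤ.+-identityʳ x)

  -- C (a - c)² = A (c² - a c) + B (a² - a c) is nonnegative, so a = c, and then a² ≤ 0.
  between⇒≡ : 0ℤ ≤ A → 0ℤ ≤ B → C < 0ℤ → C * (a - c) ≡ A * (- c) + B * a → a * c ≤ 0ℤ → a ≡ 0ℤ
  between⇒≡ {A} {B} {C} {a} {c} 0≤A 0≤B C<0 interpolation ac≤0 =
    i*i≤0⇒i≡0 (subst (λ z → a * z ≤ 0ℤ) (sym a≡c) ac≤0)
    where
    0≤-ac : 0ℤ ≤ - (a * c)
    0≤-ac = ℤ.neg-mono-≤ ac≤0
    expand : A * (c * c - a * c) + B * (a * a - a * c) ≡ C * ((a - c) * (a - c))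
    expand = begin
      A * (c * c - a * c) + B * (a * a - a * c) ≡⟨ ℤ-Solver.solve (A ∷ B ∷ a ∷ c ∷ []) ⟩
      (A * (- c) + B * a) * (a - c)             ≡⟨ cong (_* (a - c)) interpolation ⟨
      C * (a - c) * (a - c)                     ≡⟨ ℤ.*-assoc C (a - c) (a - c) ⟩
      C * ((a - c) * (a - c))                   ∎
      where open ≡-Reasoning
    a≡c : a ≡ c
    a≡c = ℤ.i-j≡0⇒i≡j a c (i*i≤0⇒i≡0 (neg*nonNeg⇒nonPos C<0 (subst (0ℤ ≤_) expand
      (ℤ.+-mono-≤ (*-nonNeg 0≤A (ℤ.+-mono-≤ (0≤i*i c) 0≤-ac)) (*-nonNeg 0≤B (ℤ.+-mono-≤ (0≤i*i a) 0≤-ac))))))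

  separated⇒¬OnSegment : ∀ α β γ {p q w} →
    0ℤ ≤ affine α β γ p → 0ℤ ≤ affine α β γ q → affine α β γ w < 0ℤ → ¬ OnSegment p q w
  separated⇒¬OnSegment α β γ {p@(px , py)} {q@(qx , qy)} {w@(wx , wy)} 0≤ℓp 0≤ℓq ℓw<0 (o≡0 , x-between , y-between) =
    ℤ.<-irrefl refl (ℤ.<-≤-trans ℓw<0 (subst (λ z → 0ℤ ≤ affine α β γ z) (sym w≡p) 0≤ℓp))
    where
    w≡p : w ≡ p
    w≡p = cong₂ _,_
      (ℤ.i-j≡0⇒i≡j wx px (between⇒≡ 0≤ℓp 0≤ℓq ℓw<0
        (trans (interpolation-x px py qx qy wx wy α β γ) (+-*-zero _ β o≡0)) x-between))
      (ℤ.i-j≡0⇒i≡j wy py (between⇒≡ 0≤ℓp 0≤ℓq ℓw<0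
        (trans (interpolation-y px py qx qy wx wy α β γ) (+-*-zero _ (- α) o≡0)) y-between))

  affine-difference : ∀ a₁ a₂ a₀ b₁ b₂ b₀ p →
    affine (b₁ - a₁) (b₂ - a₂) (b₀ - a₀) p ≡ affine b₁ b₂ b₀ p - affine a₁ a₂ a₀ p
  affine-difference a₁ a₂ a₀ b₁ b₂ b₀ (x , y) = difference a₁ a₂ a₀ b₁ b₂ b₀ x y
    where
    difference : ∀ a₁ a₂ a₀ b₁ b₂ b₀ x y →
      (b₁ - a₁) * x + (b₂ - a₂) * y + (b₀ - a₀) ≡ (b₁ * x + b₂ * y + b₀) - (a₁ * x + a₂ * y + a₀)
    difference = ℤ-Solver.solve-∀

  orient-start : ∀ a b → orient a b a ≡ 0ℤ
  orient-start (ax , ay) (bx , by) = collinear ax ay bx by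
    where
    collinear : ∀ ax ay bx by → (bx - ax) * (ay - ay) - (by - ay) * (ax - ax) ≡ 0ℤ
    collinear = ℤ-Solver.solve-∀

  orient-end : ∀ a b → orient a b b ≡ 0ℤ
  orient-end (ax , ay) (bx , by) = collinear ax ay bx by
    where
    collinear : ∀ ax ay bx by → (bx - ax) * (by - ay) - (by - ay) * (bx - ax) ≡ 0ℤ
    collinear = ℤ-Solver.solve-∀

  orient-flip : ∀ a b c → orient b a c ≡ - orient a b c
  orient-flip (ax , ay) (bx , by) (cx , cy) = antisymmetric ax ay bx by cx cy
    where
    antisymmetric : ∀ ax ay bx by cx cy →
      (ax - bx) * (cy - by) - (ay - by) * (cx - bx) ≡ - ((bx - ax) * (cy - ay) - (by - ay) * (cx - ax))
    antisymmetric = ℤ-Solver.solve-∀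

  private
    neg*neg : ∀ x y → - x * - y ≡ x * y
    neg*neg = ℤ-Solver.solve-∀

    0≮0 : ∀ {i} → i ≡ 0ℤ → ¬ (i < 0ℤ)
    0≮0 refl = ℤ.<-irrefl refl

  collinear₃⇒¬ProperCross : ∀ {a b c d} → orient a b c ≡ 0ℤ → ¬ ProperCross a b c d
  collinear₃⇒¬ProperCross {a} {b} {c} {d} abc≡0 (abcd<0 , _) =
    0≮0 (trans (cong (_* orient a b d) abc≡0) (ℤ.*-zeroˡ (orient a b d))) abcd<0

  collinear₄⇒¬ProperCross : ∀ {a b c d} → orient a b d ≡ 0ℤ → ¬ ProperCross a b c d
  collinear₄⇒¬ProperCross {a} {b} {c} {d} abd≡0 (abcd<0 , _) =
    0≮0 (trans (cong (orient a b c *_) abd≡0) (ℤ.*-zeroʳ (orient a b c))) abcd<0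

  ¬ProperCross-flip : ∀ {a b c d} → ¬ ProperCross a b c d → ¬ ProperCross b a c d
  ¬ProperCross-flip {a} {b} {c} {d} ¬abcd (bacd<0 , cdba<0) = ¬abcd
    ( subst (_< 0ℤ) (trans (cong₂ _*_ (orient-flip a b c) (orient-flip a b d)) (neg*neg (orient a b c) (orient a b d))) bacd<0
    , subst (_< 0ℤ) (ℤ.*-comm (orient c d b) (orient c d a)) cdba<0 )

  ¬OnSegment-flip : ∀ {p q w} → ¬ OnSegment p q w → ¬ OnSegment q p w
  ¬OnSegment-flip {p@(px , py)} {q@(qx , qy)} {w@(wx , wy)} ¬pqw (qpw≡0 , x-between , y-between) = ¬pqw
    ( trans (orient-flip q p w) (cong -_ qpw≡0)
    , subst (_≤ 0ℤ) (ℤ.*-comm (wx - qx) (wx - px)) x-between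
    , subst (_≤ 0ℤ) (ℤ.*-comm (wy - qy) (wy - py)) y-between )

open import Data.Bool using (Bool; true; false; _∧_; _xor_; if_then_else_)
open import Data.Bool.Properties using (∧-zeroʳ; xor-same; xor-comm; ∨-comm)
open import Data.Fin using (Fin; zero; suc; toℕ)
open import Data.Fin.Properties using (toℕ-injective; toℕ<n)
open import Function.Definitions using (Injective)
open import Data.Fin.Subset using (Subset; ∣_∣)
open import Data.List.Relation.Unary.All as All using (All)
open import Data.Nat as ℕ using (ℕ; zero; suc; _+_; _*_; _≤_; _<_; z≤n; s≤s; ⌈_/2⌉; ⌊_/2⌋; _≤?_; _≟_)
open import Data.Nat.Divisibility using (_∣_; divides)

open import Data.Nat.Properties
open import Algebra.Properties.CommutativeMonoid.Sum +-0-commutativeMonoid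
  using (sum; sum-syntax; sum-cong-≗; ∑-distrib-+)
open import Algebra.Properties.CommutativeSemigroup +-commutativeSemigroup
  using (interchange; xy∙z≈xz∙y)
open import Data.Integer.Base as ℤ using (ℤ; 0ℤ)
import Data.Integer.Properties as ℤ
open import Data.List using (List; []; _∷_; length)
open import Data.Nat.Tactic.RingSolver using (solve; solve-∀)
open import Data.Product using (Σ; _×_; _,_; proj₁; proj₂)
open import Data.Unit using (⊤; tt)
open import Data.Vec as Vec using (lookup)
open import Function using (_∘_)
open import Relation.Nullary using (¬_; contradiction; Dec; yes; no; does)
open import Relation.Nullary.Decidable using (map′; _⊎-dec_; dec-true; dec-false)
open import Data.Sum using (_⊎_; inj₁; inj₂)
open import Relation.Binary.PropositionalEquality
  using (_≡_; _≢_; refl; sym; trans; cong; cong₂; subst; subst₂; module ≡-Reasoning)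

open Geometry
  using ( affine; affine-difference; i<j⇒i-j<0; separated⇒¬ProperCross; separated⇒¬OnSegment; orient-start; orient-end
        ; collinear₃⇒¬ProperCross; collinear₄⇒¬ProperCross; ¬ProperCross-flip; ¬OnSegment-flip )

-- Inversions

𝟙 : Bool → ℕ
𝟙 true  = 1
𝟙 false = 0

𝟙≤1 : ∀ b → 𝟙 b ≤ 1
𝟙≤1 true  = ≤-refl
𝟙≤1 false = z≤n

sum-mono-≤ : ∀ {n} {f g : Fin n → ℕ} → (∀ i → f i ≤ g i) → sum f ≤ sum g
sum-mono-≤ {zero}  f≤g = z≤n
sum-mono-≤ {suc n} f≤g = +-mono-≤ (f≤g zero) (sum-mono-≤ (f≤g ∘ suc))

sum-zero : ∀ {n} {f : Fin n → ℕ} → (∀ i → f i ≡ 0) → sum f ≡ 0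
sum-zero {zero}  f≡0 = refl
sum-zero {suc n} f≡0 = cong₂ _+_ (f≡0 zero) (sum-zero (f≡0 ∘ suc))

sum-≤-+ : ∀ {n} {f g h : Fin n → ℕ} → (∀ u → f u ≤ g u + h u) → sum f ≤ sum g + sum h
sum-≤-+ {g = g} {h} f≤g+h = ≤-trans (sum-mono-≤ f≤g+h) (≤-reflexive (∑-distrib-+ g h))

sum-+-except : ∀ {n} {f g h : Fin n → ℕ} (v : Fin n) → f v ≤ g v →
               (∀ u → f u ≤ g u + h u) → sum f + h v ≤ sum g + sum h
sum-+-except {suc n} {f} {g} {h} zero f₀≤g₀ f≤g+h = begin
  f zero + sum (f ∘ suc) + h zero           ≡⟨ xy∙z≈xz∙y (f zero) _ _ ⟩
  f zero + h zero + sum (f ∘ suc)           ≤⟨ +-mono-≤ (+-monoˡ-≤ (h zero) f₀≤g₀) (sum-≤-+ (f≤g+h ∘ suc)) ⟩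
  g zero + h zero + (sum (g ∘ suc) + sum (h ∘ suc)) ≡⟨ interchange (g zero) _ _ _ ⟩
  sum g + sum h                             ∎
  where open ≤-Reasoning
sum-+-except {suc n} {f} {g} {h} (suc v) fᵥ≤gᵥ f≤g+h = begin
  f zero + sum (f ∘ suc) + h (suc v)        ≡⟨ +-assoc (f zero) _ _ ⟩
  f zero + (sum (f ∘ suc) + h (suc v))      ≤⟨ +-mono-≤ (f≤g+h zero) (sum-+-except v fᵥ≤gᵥ (f≤g+h ∘ suc)) ⟩
  g zero + h zero + (sum (g ∘ suc) + sum (h ∘ suc)) ≡⟨ interchange (g zero) _ _ _ ⟩
  sum g + sum h                             ∎
  where open ≤-Reasoning

∣∣≡∑𝟙 : ∀ {n} (X : Subset n) → ∣ X ∣ ≡ ∑[ u < n ] 𝟙 (lookup X u)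
∣∣≡∑𝟙 Vec.[]          = refl
∣∣≡∑𝟙 (true  Vec.∷ X) = cong suc (∣∣≡∑𝟙 X)
∣∣≡∑𝟙 (false Vec.∷ X) = ∣∣≡∑𝟙 X

degree : ∀ {n} → Graph n → Fin n → ℕ
degree {n} G v = ∑[ u < n ] 𝟙 (adj G u v)

module Potential {n : ℕ} (o : Orient n) where

  mismatch : Orient n → Fin n → ℕ
  mismatch d v = ∑[ u < n ] 𝟙 (d u v xor o u v)

  potential : Orient n → ℕ
  potential d = ∑[ v < n ] ⌈ mismatch d v /2⌉

  potential-self : potential o ≡ 0
  potential-self = sum-zero λ v → cong ⌈_/2⌉ (sum-zero λ u → cong 𝟙 (xor-same (o u v)))

  module _ (X : Subset n) (d : Orient n) (v : Fin n) where

    mismatch-invert-outside : lookup X v ≡ false → mismatch (invert X d) v ≡ mismatch d v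
    mismatch-invert-outside v∉X = sum-cong-≗ λ u →
      cong (λ b → 𝟙 ((if b then d v u else d u v) xor o u v))
           (trans (cong (lookup X u ∧_) v∉X) (∧-zeroʳ (lookup X u)))

    mismatch-invert-inside : lookup X v ≡ true → mismatch (invert X d) v + 1 ≤ mismatch d v + ∣ X ∣
    mismatch-invert-inside v∈X = subst₂ _≤_
      (cong (mismatch (invert X d) v +_) (cong 𝟙 v∈X))
      (cong (mismatch d v +_) (sym (∣∣≡∑𝟙 X)))
      (sum-+-except v loop-unchanged arc-grows)
      where
      loop-unchanged : 𝟙 (invert X d v v xor o v v) ≤ 𝟙 (d v v xor o v v)
      loop-unchanged with lookup X v ∧ lookup X v
      ... | true  = ≤-refl
      ... | false = ≤-refl
      arc-grows : ∀ u → 𝟙 (invert X d u v xor o u v) ≤ 𝟙 (d u v xor o u v) + 𝟙 (lookup X u)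
      arc-grows u with lookup X u
      ... | false = m≤m+n _ _
      ... | true  = ≤-trans (𝟙≤1 _) (m≤n+m _ _)

    half-mismatch-invert : ∣ X ∣ ≤ 3 →
      ⌈ mismatch (invert X d) v /2⌉ ≤ ⌈ mismatch d v /2⌉ + 𝟙 (lookup X v)
    half-mismatch-invert ∣X∣≤3 = by-membership (lookup X v) refl
      where
      by-membership : ∀ b → lookup X v ≡ b → ⌈ mismatch (invert X d) v /2⌉ ≤ ⌈ mismatch d v /2⌉ + 𝟙 b
      by-membership false v∉X =
        ≤-reflexive (trans (cong ⌈_/2⌉ (mismatch-invert-outside v∉X)) (sym (+-identityʳ _)))
      by-membership true v∈X = ≤-trans (⌈n/2⌉-mono grows-by-two) (≤-reflexive (+-comm 1 _))
        where
        grows-by-two : mismatch (invert X d) v ≤ 2 + mismatch d v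
        grows-by-two = +-cancelʳ-≤ 1 _ _ (begin
          mismatch (invert X d) v + 1 ≤⟨ mismatch-invert-inside v∈X ⟩
          mismatch d v + ∣ X ∣        ≤⟨ +-monoʳ-≤ (mismatch d v) ∣X∣≤3 ⟩
          mismatch d v + (2 + 1)      ≡⟨ +-assoc (mismatch d v) 2 1 ⟨
          mismatch d v + 2 + 1        ≡⟨ cong (_+ 1) (+-comm (mismatch d v) 2) ⟩
          2 + mismatch d v + 1        ∎)
          where open ≤-Reasoning

  potential-invert : ∀ X d → ∣ X ∣ ≤ 3 → potential (invert X d) ≤ potential d + ∣ X ∣
  potential-invert X d ∣X∣≤3 = begin
    potential (invert X d)                                  ≤⟨ sum-mono-≤ (λ v → half-mismatch-invert X d v ∣X∣≤3) ⟩
    ∑[ v < n ] (⌈ mismatch d v /2⌉ + 𝟙 (lookup X v))     ≡⟨ ∑-distrib-+ (λ v → ⌈ mismatch d v /2⌉) (𝟙 ∘ lookup X) ⟩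
    potential d + ∑[ v < n ] 𝟙 (lookup X v)               ≡⟨ cong (potential d +_) (sym (∣∣≡∑𝟙 X)) ⟩
    potential d + ∣ X ∣                                     ∎
    where open ≤-Reasoning

  potential-invertAll : ∀ Xs d → All (λ X → ∣ X ∣ ≤ 3) Xs →
                        potential (invertAll Xs d) ≤ potential d + 3 * length Xs
  potential-invertAll []       d All.[]           = m≤m+n _ _
  potential-invertAll (X ∷ Xs) d (∣X∣≤3 All.∷ ≤3) = begin
    potential (invertAll Xs (invert X d))       ≤⟨ potential-invertAll Xs (invert X d) ≤3 ⟩
    potential (invert X d) + 3 * length Xs      ≤⟨ +-monoˡ-≤ _ (potential-invert X d ∣X∣≤3) ⟩
    potential d + ∣ X ∣ + 3 * length Xs         ≤⟨ +-monoˡ-≤ _ (+-monoʳ-≤ (potential d) ∣X∣≤3) ⟩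
    potential d + 3 + 3 * length Xs             ≡⟨ +-assoc (potential d) 3 _ ⟩
    potential d + (3 + 3 * length Xs)           ≡⟨ cong (potential d +_) (*-suc 3 (length Xs)) ⟨
    potential d + 3 * length (X ∷ Xs)           ∎
    where open ≤-Reasoning

  mismatch-converse : ∀ {G} → IsOrientation G o → ∀ v → mismatch (λ u w → o w u) v ≡ degree G v
  mismatch-converse {G} (arc⇒edge , edge⇒arc) v = sum-cong-≗ λ u → cong 𝟙 (converse-differs u v)
    where
    no-arc : ∀ u v → adj G u v ≡ false → o u v ≡ false
    no-arc u v uv∉G with o u v in uv
    ... | false = refl
    ... | true  = contradiction (trans (sym uv∉G) (arc⇒edge u v uv)) λ ()
    converse-differs : ∀ u v → (o v u xor o u v) ≡ adj G u v
    converse-differs u v with adj G u v in uv∈G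
    ... | true  = trans (xor-comm (o v u) (o u v)) (edge⇒arc u v uv∈G)
    ... | false = cong₂ _xor_ (no-arc v u (trans (Graph.sym G v u) uv∈G)) (no-arc u v uv∈G)

∑⌈degree/2⌉≤3*length : ∀ {n} (G : Graph n) o → IsOrientation G o → ∀ Xs → ConvSeq≤3 o Xs →
                      ∑[ v < n ] ⌈ degree G v /2⌉ ≤ 3 * length Xs
∑⌈degree/2⌉≤3*length G o isOrient Xs (≤3 , converse) = begin
  ∑[ v < _ ] ⌈ degree G v /2⌉ ≡⟨ sum-cong-≗ (cong ⌈_/2⌉ ∘ mismatch-converse {G = G} isOrient) ⟨
  potential (λ u w → o w u)  ≡⟨ sum-cong-≗ (λ v → cong ⌈_/2⌉ (sum-cong-≗ λ u → cong (λ b → 𝟙 (b xor o u v)) (converse u v))) ⟨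
  potential (invertAll Xs o) ≤⟨ potential-invertAll Xs o ≤3 ⟩
  potential o + 3 * length Xs ≡⟨ cong (_+ 3 * length Xs) potential-self ⟩
  3 * length Xs ∎
  where
  open Potential o
  open ≤-Reasoning

-- Separation certificates for drawings with natural coordinates

pt : ℕ → ℕ → Point
pt x y = ℤ.+ x , ℤ.+ y

infix 5 _x+_y+_
data Affine : Set where
  _x+_y+_ : ℕ → ℕ → ℕ → Affine

infix 4 _≼_
data Line : Set where
  _≼_ : Affine → Affine → Line

-- Spelled out (rather than via an evaluation function) so that side
-- conditions reduce to plain arithmetic for the ring solver.
Within Beyond : Line → ℕ → ℕ → Set
Within (a₁ x+ a₂ y+ a₀ ≼ b₁ x+ b₂ y+ b₀) x y = a₁ * x + a₂ * y + a₀ ≤ b₁ * x + b₂ * y + b₀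
Beyond (a₁ x+ a₂ y+ a₀ ≼ b₁ x+ b₂ y+ b₀) x y = b₁ * x + b₂ * y + b₀ < a₁ * x + a₂ * y + a₀

level : Line → Point → ℤ
level (a₁ x+ a₂ y+ a₀ ≼ b₁ x+ b₂ y+ b₀) = affine (ℤ.+ b₁ ℤ.- ℤ.+ a₁) (ℤ.+ b₂ ℤ.- ℤ.+ a₂) (ℤ.+ b₀ ℤ.- ℤ.+ a₀)

affine-pt : ∀ c₁ c₂ c₀ x y → ℤ.+ (c₁ * x + c₂ * y + c₀) ≡ affine (ℤ.+ c₁) (ℤ.+ c₂) (ℤ.+ c₀) (pt x y)
affine-pt c₁ c₂ c₀ x y = trans (ℤ.pos-+ (c₁ * x + c₂ * y) c₀) (cong (ℤ._+ ℤ.+ c₀)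
  (trans (ℤ.pos-+ (c₁ * x) (c₂ * y)) (cong₂ ℤ._+_ (ℤ.pos-* c₁ x) (ℤ.pos-* c₂ y))))

level-pt : ∀ a₁ a₂ a₀ b₁ b₂ b₀ x y → level (a₁ x+ a₂ y+ a₀ ≼ b₁ x+ b₂ y+ b₀) (pt x y) ≡
           ℤ.+ (b₁ * x + b₂ * y + b₀) ℤ.- ℤ.+ (a₁ * x + a₂ * y + a₀)
level-pt a₁ a₂ a₀ b₁ b₂ b₀ x y = trans (affine-difference (ℤ.+ a₁) (ℤ.+ a₂) (ℤ.+ a₀) (ℤ.+ b₁) (ℤ.+ b₂) (ℤ.+ b₀) (pt x y))
  (sym (cong₂ ℤ._-_ (affine-pt b₁ b₂ b₀ x y) (affine-pt a₁ a₂ a₀ x y)))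

within⇒0≤level : ∀ L {x y} → Within L x y → 0ℤ ℤ.≤ level L (pt x y)
within⇒0≤level (a₁ x+ a₂ y+ a₀ ≼ b₁ x+ b₂ y+ b₀) {x} {y} f≤g =
  subst (0ℤ ℤ.≤_) (sym (level-pt a₁ a₂ a₀ b₁ b₂ b₀ x y)) (ℤ.i≤j⇒0≤j-i (ℤ.+≤+ f≤g))

beyond⇒level<0 : ∀ L {x y} → Beyond L x y → level L (pt x y) ℤ.< 0ℤ
beyond⇒level<0 (a₁ x+ a₂ y+ a₀ ≼ b₁ x+ b₂ y+ b₀) {x} {y} g<f =
  subst (ℤ._< 0ℤ) (sym (level-pt a₁ a₂ a₀ b₁ b₂ b₀ x y)) (i<j⇒i-j<0 (ℤ.+<+ g<f))

-- Records, so that the points are fixed by the goal before the arithmetic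
-- side conditions of a certificate are elaborated.
record NoCross (a b c d : Point) : Set where
  constructor noCross
  field ¬properCross : ¬ ProperCross a b c d

record NotOn (p q w : Point) : Set where
  constructor notOn
  field ¬onSegment : ¬ OnSegment p q w

open NoCross
open NotOn

separates : ∀ L {ax ay bx by cx cy dx dy} →
  Within L ax ay → Within L bx by → Beyond L cx cy → Beyond L dx dy →
  NoCross (pt ax ay) (pt bx by) (pt cx cy) (pt dx dy)
separates L@(a₁ x+ a₂ y+ a₀ ≼ b₁ x+ b₂ y+ b₀) a b c d = noCross (separated⇒¬ProperCross
  (ℤ.+ b₁ ℤ.- ℤ.+ a₁) (ℤ.+ b₂ ℤ.- ℤ.+ a₂) (ℤ.+ b₀ ℤ.- ℤ.+ a₀)
  (within⇒0≤level L a) (within⇒0≤level L b) (beyond⇒level<0 L c) (beyond⇒level<0 L d))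

excludes : ∀ L {px py qx qy wx wy} →
  Within L px py → Within L qx qy → Beyond L wx wy → NotOn (pt px py) (pt qx qy) (pt wx wy)
excludes L@(a₁ x+ a₂ y+ a₀ ≼ b₁ x+ b₂ y+ b₀) p q w = notOn (separated⇒¬OnSegment
  (ℤ.+ b₁ ℤ.- ℤ.+ a₁) (ℤ.+ b₂ ℤ.- ℤ.+ a₂) (ℤ.+ b₀ ℤ.- ℤ.+ a₀)
  (within⇒0≤level L p) (within⇒0≤level L q) (beyond⇒level<0 L w))

≤-by : ∀ {m n} k → m + k ≡ n → m ≤ n
≤-by {m} k refl = m≤m+n m k

meets₁₁ : ∀ {a b d} → NoCross a b a d
meets₁₁ {a} {b} {d} = noCross (collinear₃⇒¬ProperCross {a} {b} {a} {d} (orient-start a b))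

meets₂₁ : ∀ {a b d} → NoCross a b b d
meets₂₁ {a} {b} {d} = noCross (collinear₃⇒¬ProperCross {a} {b} {b} {d} (orient-end a b))

meets₁₂ : ∀ {a b c} → NoCross a b c a
meets₁₂ {a} {b} {c} = noCross (collinear₄⇒¬ProperCross {a} {b} {c} {a} (orient-start a b))

meets₂₂ : ∀ {a b c} → NoCross a b c b
meets₂₂ {a} {b} {c} = noCross (collinear₄⇒¬ProperCross {a} {b} {c} {b} (orient-end a b))

swap : ∀ {a b c d} → NoCross c d a b → NoCross a b c d
swap (noCross ¬cdab) = noCross λ (abcd , cdab) → ¬cdab (cdab , abcd)

flip₁ : ∀ {a b c d} → NoCross a b c d → NoCross b a c d
flip₁ {a} {b} {c} {d} (noCross ¬abcd) = noCross (¬ProperCross-flip {a} {b} {c} {d} ¬abcd)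

flip₂ : ∀ {a b c d} → NoCross a b c d → NoCross a b d c
flip₂ = swap ∘ flip₁ ∘ swap

double : ℕ → ℕ
double zero    = zero
double (suc n) = suc (suc (double n))

double-≤-cancel : ∀ {m n} → double m ≤ suc (double n) → m ≤ n
double-≤-cancel {zero}          _               = z≤n
double-≤-cancel {suc m} {zero}  (s≤s ())
double-≤-cancel {suc m} {suc n} (s≤s (s≤s dm≤)) = s≤s (double-≤-cancel dm≤)

⌊double/2⌋ : ∀ n → ⌊ double n /2⌋ ≡ n
⌊double/2⌋ zero    = refl
⌊double/2⌋ (suc n) = cong suc (⌊double/2⌋ n)

double≡+ : ∀ n → double n ≡ n + n
double≡+ zero    = refl
double≡+ (suc n) = cong suc (trans (cong suc (double≡+ n)) (sym (+-suc n n)))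

double-double : ∀ k → double (double k) ≡ k * 4
double-double zero    = refl
double-double (suc k) = cong (4 +_) (double-double k)

-- A view of the order of two numbers with the gap added on the left, so that
-- a gap of zero makes the indices definitionally adjacent.
data Comparison : ℕ → ℕ → Set where
  less    : ∀ i k → Comparison i (suc (k + i))
  equal   : ∀ i → Comparison i i
  greater : ∀ j k → Comparison (suc (k + j)) j

cmp : ∀ i j → Comparison i j
cmp i j with ℕ.compare i j
... | ℕ.less .i k    = subst (Comparison i) (cong suc (+-comm k i)) (less i k)
... | ℕ.equal .i     = equal i
... | ℕ.greater .j k = subst (λ m → Comparison m j) (cong suc (+-comm k j)) (greater j k)

gap : ∀ {i q} → i ≤ q → Σ ℕ λ r → r + i ≡ q
gap {i} i≤q with m≤n⇒∃[o]m+o≡n i≤q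
... | r , i+r≡q = r , trans (+-comm r i) i+r≡q

∑< : ℕ → (ℕ → ℕ) → ℕ
∑< zero    g = 0
∑< (suc n) g = g 0 + ∑< n (g ∘ suc)

sum≡∑< : ∀ n g → ∑[ i < n ] g (toℕ i) ≡ ∑< n g
sum≡∑< zero    g = refl
sum≡∑< (suc n) g = cong (g 0 +_) (sum≡∑< n (g ∘ suc))

∑<-cong : ∀ n {g h} → (∀ t → g t ≡ h t) → ∑< n g ≡ ∑< n h
∑<-cong zero    g≗h = refl
∑<-cong (suc n) g≗h = cong₂ _+_ (g≗h 0) (∑<-cong n (g≗h ∘ suc))

∑<-mono : ∀ n {g h} → (∀ t → t < n → g t ≤ h t) → ∑< n g ≤ ∑< n h
∑<-mono zero    g≤h = z≤n
∑<-mono (suc n) g≤h = +-mono-≤ (g≤h 0 (s≤s z≤n)) (∑<-mono n λ t t<n → g≤h (suc t) (s≤s t<n))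

∑<-const : ∀ n c → ∑< n (λ _ → c) ≡ n * c
∑<-const zero    c = refl
∑<-const (suc n) c = cong (c +_) (∑<-const n c)

∑<-lower : ∀ n {c g} → (∀ t → t < n → c ≤ g t) → n * c ≤ ∑< n g
∑<-lower n {c} c≤g = ≤-trans (≤-reflexive (sym (∑<-const n c))) (∑<-mono n c≤g)

∑<-last : ∀ n g → ∑< (suc n) g ≡ ∑< n g + g n
∑<-last zero    g = +-comm (g 0) 0
∑<-last (suc n) g = trans (cong (g 0 +_) (∑<-last n (g ∘ suc))) (sym (+-assoc (g 0) _ _))

∑<-prefix : ∀ {w n} g → w ≤ n → ∑< w g ≤ ∑< n g
∑<-prefix {zero}          g _         = z≤n
∑<-prefix {suc w} {suc n} g (s≤s w≤n) = +-monoʳ-≤ (g 0) (∑<-prefix (g ∘ suc) w≤n)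

∑<-window : ∀ m w n g → m + w ≤ n → ∑< w (λ t → g (t + m)) ≤ ∑< n g
∑<-window zero    w n       g w≤n =
  ≤-trans (≤-reflexive (∑<-cong w (λ t → cong g (+-identityʳ t)))) (∑<-prefix g w≤n)
∑<-window (suc m) w (suc n) g (s≤s m+w≤n) = ≤-trans (≤-reflexive (∑<-cong w (λ t → cong g (+-suc t m))))
  (≤-trans (∑<-window m w n (g ∘ suc) m+w≤n) (m≤n+m _ (g 0)))

∑<-pair-shift : ∀ n (a b : ℕ → ℕ) → ∑< (suc n) (λ t → a t + b t) ≡ b 0 + ∑< n (λ t → a t + b (suc t)) + a n
∑<-pair-shift zero    a b = rearrange (a 0) (b 0)
  where
  rearrange : ∀ a₀ b₀ → a₀ + b₀ + 0 ≡ b₀ + 0 + a₀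
  rearrange = solve-∀
∑<-pair-shift (suc n) a b = trans (cong (a 0 + b 0 +_) (∑<-pair-shift n (a ∘ suc) (b ∘ suc)))
  (rearrange (a 0) (b 0) (b 1) (∑< n (λ t → a (suc t) + b (suc (suc t)))) (a (suc n)))
  where
  rearrange : ∀ a₀ b₀ b₁ s aₙ → a₀ + b₀ + (b₁ + s + aₙ) ≡ b₀ + (a₀ + b₁ + s) + aₙ
  rearrange = solve-∀

does⇒ : ∀ {A : Set} (a? : Dec A) → does a? ≡ true → A
does⇒ (yes a) _ = a

-- The graph

data Vertex : Set where
  top bot : Vertex
  up lo   : ℕ → Vertex

column : ℕ → ℕ → Vertex
column i zero          = up i
column i (suc zero)    = lo i
column i (suc (suc m)) = column (suc i) m

vertex : ℕ → Vertex
vertex zero          = top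
vertex (suc zero)    = bot
vertex (suc (suc m)) = column 0 m

index : Vertex → ℕ
index top    = 0
index bot    = 1
index (up i) = 2 + double i
index (lo i) = 3 + double i

index-column : ∀ i m → index (column i m) ≡ 2 + (m + double i)
index-column i zero          = refl
index-column i (suc zero)    = refl
index-column i (suc (suc m)) = trans (index-column (suc i) m)
  (cong (2 +_) (trans (+-suc m (suc (double i))) (cong suc (+-suc m (double i)))))

index-vertex : ∀ x → index (vertex x) ≡ x
index-vertex zero          = refl
index-vertex (suc zero)    = refl
index-vertex (suc (suc m)) = trans (index-column 0 m) (cong (2 +_) (+-identityʳ m))

vertex-injective : ∀ {x y} → vertex x ≡ vertex y → x ≡ y
vertex-injective {x} {y} eq = trans (sym (index-vertex x)) (trans (cong index eq) (index-vertex y))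

∑<-columns : ∀ m i (f : Vertex → ℕ) →
             ∑< (double m) (f ∘ column i) ≡ ∑< m (λ t → f (up (t + i)) + f (lo (t + i)))
∑<-columns zero    i f = refl
∑<-columns (suc m) i f = trans (sym (+-assoc (f (up i)) (f (lo i)) _)) (cong (f (up i) + f (lo i) +_)
  (trans (∑<-columns m (suc i) f) (∑<-cong m λ t → cong (λ j → f (up j) + f (lo j)) (+-suc t i))))

∑<-vertices : ∀ m (f : Vertex → ℕ) →
              ∑< (2 + double m) (f ∘ vertex) ≡ f top + (f bot + ∑< m (λ t → f (up t) + f (lo t)))
∑<-vertices m f = cong (λ s → f top + (f bot + s))
  (trans (∑<-columns m 0 f) (∑<-cong m λ t → cong (λ j → f (up j) + f (lo j)) (+-identityʳ t)))

module Construction (q : ℕ) where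

  position : Vertex → Point
  position top    = pt (2 + 2 * q) (5 + 4 * q)
  position bot    = pt 0 0
  position (up i) = pt (1 + 2 * i) 2
  position (lo i) = pt (2 + 2 * i) 1

  InRange : Vertex → Set
  InRange top    = ⊤
  InRange bot    = ⊤
  InRange (up i) = i ≤ q
  InRange (lo i) = i ≤ q

  data Edge : Vertex → Vertex → Set where
    top-up      : ∀ {i} → i ≤ q → Edge top (up i)
    bot-lo      : ∀ {i} → i ≤ q → Edge bot (lo i)
    up-up       : ∀ {i} → i < q → Edge (up i) (up (suc i))
    lo-lo       : ∀ {i} → i < q → Edge (lo i) (lo (suc i))
    up-lo       : ∀ {i} → i ≤ q → Edge (up i) (lo i)
    up-lo⁺      : ∀ {i} → i < q → Edge (up i) (lo (suc i))
    top-bot     : Edge top bot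
    up₀-bot     : Edge (up 0) bot
    top-lo-last : Edge top (lo q)

  NoCrossing : Vertex → Vertex → Vertex → Vertex → Set
  NoCrossing a b c d = NoCross (position a) (position b) (position c) (position d)

  NotOnSegment : Vertex → Vertex → Vertex → Set
  NotOnSegment a b w = NotOn (position a) (position b) (position w)

  top-up-∦ : ∀ {i c d} → i ≤ q → Edge c d → NoCrossing top (up i) c d
  top-up-∦ _ (top-up _) = meets₁₁
  top-up-∦ {i} _ (bot-lo {j} _) = separates (0 x+ 0 y+ 2 ≼ 0 x+ 1 y+ 0)
    (≤-by (3 + 4 * q) (solve (q ∷ []))) (≤-by 0 (solve (i ∷ [])))
    (≤-by 1 refl) (≤-by 0 (solve (j ∷ [])))
  top-up-∦ {i} _ (lo-lo {j} _) = separates (0 x+ 0 y+ 2 ≼ 0 x+ 1 y+ 0)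
    (≤-by (3 + 4 * q) (solve (q ∷ []))) (≤-by 0 (solve (i ∷ [])))
    (≤-by 0 (solve (j ∷ []))) (≤-by 0 (solve (j ∷ [])))
  top-up-∦ _ top-bot = meets₁₁
  top-up-∦ _ top-lo-last = meets₁₁
  top-up-∦ {zero} _ up₀-bot = meets₂₁
  top-up-∦ {suc i} hi up₀-bot with gap hi
  ... | r , refl = separates (0 x+ 0 y+ (7 + 2 * i) ≼ 1 x+ 2 y+ 0)
    (≤-by (15 + 8 * i + 10 * r) (solve (i ∷ r ∷ []))) (≤-by 0 (solve (i ∷ [])))
    (≤-by (1 + 2 * i) (solve (i ∷ []))) (≤-by (6 + 2 * i) (solve (i ∷ [])))
  top-up-∦ {i} hi (up-lo {j} _) with cmp j i
  ... | equal _ = meets₂₁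
  ... | greater _ k = separates (1 x+ 0 y+ 4 ≼ 0 x+ 2 y+ (1 + 2 * i))
    (≤-by (5 + 2 * i + 6 * q) (solve (i ∷ q ∷ []))) (≤-by 0 (solve (i ∷ [])))
    (≤-by (1 + 2 * k) (solve (i ∷ k ∷ []))) (≤-by (4 + 2 * k) (solve (i ∷ k ∷ [])))
  ... | less _ k with gap hi
  ...   | r , refl = separates (0 x+ 0 y+ (7 + 2 * j + 2 * k) ≼ 1 x+ 2 y+ 0)
      (≤-by (15 + 8 * j + 8 * k + 10 * r) (solve (j ∷ k ∷ r ∷ []))) (≤-by 0 (solve (j ∷ k ∷ [])))
      (≤-by (1 + 2 * k) (solve (j ∷ k ∷ []))) (≤-by (2 + 2 * k) (solve (j ∷ k ∷ [])))
  top-up-∦ {i} hi (up-lo⁺ {j} _) with cmp j i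
  ... | equal _ = meets₂₁
  ... | greater _ k = separates (1 x+ 0 y+ 4 ≼ 0 x+ 2 y+ (1 + 2 * i))
    (≤-by (5 + 2 * i + 6 * q) (solve (i ∷ q ∷ []))) (≤-by 0 (solve (i ∷ [])))
    (≤-by (1 + 2 * k) (solve (i ∷ k ∷ []))) (≤-by (6 + 2 * k) (solve (i ∷ k ∷ [])))
  ... | less _ k with gap hi
  ...   | r , refl = separates (0 x+ 0 y+ (7 + 2 * j + 2 * k) ≼ 1 x+ 2 y+ 0)
      (≤-by (15 + 8 * j + 8 * k + 10 * r) (solve (j ∷ k ∷ r ∷ []))) (≤-by 0 (solve (j ∷ k ∷ [])))
      (≤-by (1 + 2 * k) (solve (j ∷ k ∷ []))) (≤-by (2 * k) (solve (j ∷ k ∷ [])))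
  top-up-∦ {i} hi (up-up {j} _) with cmp j i
  ... | equal _ = meets₂₁
  ... | greater _ k = separates (1 x+ 0 y+ 4 ≼ 0 x+ 2 y+ (1 + 2 * i))
    (≤-by (5 + 2 * i + 6 * q) (solve (i ∷ q ∷ []))) (≤-by 0 (solve (i ∷ [])))
    (≤-by (1 + 2 * k) (solve (i ∷ k ∷ []))) (≤-by (3 + 2 * k) (solve (i ∷ k ∷ [])))
  ... | less _ zero = meets₂₂
  ... | less _ (suc k) with gap hi
  ...   | r , refl = separates (0 x+ 0 y+ (9 + 2 * j + 2 * k) ≼ 1 x+ 2 y+ 0)
      (≤-by (23 + 8 * j + 8 * k + 10 * r) (solve (j ∷ k ∷ r ∷ []))) (≤-by 0 (solve (j ∷ k ∷ [])))
      (≤-by (3 + 2 * k) (solve (j ∷ k ∷ []))) (≤-by (1 + 2 * k) (solve (j ∷ k ∷ [])))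

  bot-lo-∦ : ∀ {i c d} → i ≤ q → Edge c d → NoCrossing bot (lo i) c d
  bot-lo-∦ hi (top-up hj) = swap (top-up-∦ hj (bot-lo hi))
  bot-lo-∦ _ (bot-lo _) = meets₁₁
  bot-lo-∦ {i} _ (up-up {j} _) = swap (separates (0 x+ 0 y+ 2 ≼ 0 x+ 1 y+ 0)
    (≤-by 0 (solve (j ∷ []))) (≤-by 0 (solve (j ∷ [])))
    (≤-by 1 refl) (≤-by 0 (solve (i ∷ []))))
  bot-lo-∦ {i} _ (lo-lo {j} _) with cmp j i
  ... | less _ zero = meets₂₂
  ... | less _ (suc k) = separates (0 x+ (6 + 2 * j + 2 * k) y+ 0 ≼ 1 x+ 0 y+ 0)
    (≤-by 0 (solve (j ∷ k ∷ []))) (≤-by 0 (solve (j ∷ k ∷ [])))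
    (≤-by (3 + 2 * k) (solve (j ∷ k ∷ []))) (≤-by (1 + 2 * k) (solve (j ∷ k ∷ [])))
  ... | equal _ = meets₂₁
  ... | greater _ k = separates (1 x+ 2 y+ 0 ≼ 0 x+ 0 y+ (4 + 2 * i))
    (≤-by (4 + 2 * i) (solve (i ∷ []))) (≤-by 0 (solve (i ∷ [])))
    (≤-by (1 + 2 * k) (solve (i ∷ k ∷ []))) (≤-by (3 + 2 * k) (solve (i ∷ k ∷ [])))
  bot-lo-∦ {i} _ (up-lo {j} _) with cmp j i
  ... | less _ k = separates (0 x+ (4 + 2 * j + 2 * k) y+ 0 ≼ 1 x+ 0 y+ 0)
    (≤-by 0 (solve (j ∷ k ∷ []))) (≤-by 0 (solve (j ∷ k ∷ [])))
    (≤-by (6 + 2 * j + 4 * k) (solve (j ∷ k ∷ []))) (≤-by (1 + 2 * k) (solve (j ∷ k ∷ [])))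
  ... | equal _ = meets₂₂
  ... | greater _ k = separates (1 x+ 2 y+ 0 ≼ 0 x+ 0 y+ (4 + 2 * i))
    (≤-by (4 + 2 * i) (solve (i ∷ []))) (≤-by 0 (solve (i ∷ [])))
    (≤-by (2 + 2 * k) (solve (i ∷ k ∷ []))) (≤-by (1 + 2 * k) (solve (i ∷ k ∷ [])))
  bot-lo-∦ {i} _ (up-lo⁺ {j} _) with cmp j i
  ... | less _ zero = meets₂₂
  ... | less _ (suc k) = separates (0 x+ (6 + 2 * j + 2 * k) y+ 0 ≼ 1 x+ 0 y+ 0)
    (≤-by 0 (solve (j ∷ k ∷ []))) (≤-by 0 (solve (j ∷ k ∷ [])))
    (≤-by (10 + 2 * j + 4 * k) (solve (j ∷ k ∷ []))) (≤-by (1 + 2 * k) (solve (j ∷ k ∷ [])))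
  ... | equal _ = separates (1 x+ 2 y+ 0 ≼ 0 x+ 0 y+ (4 + 2 * i))
    (≤-by (4 + 2 * i) (solve (i ∷ []))) (≤-by 0 (solve (i ∷ [])))
    (≤-by 0 (solve (i ∷ []))) (≤-by 1 (solve (i ∷ [])))
  ... | greater _ k = separates (1 x+ 2 y+ 0 ≼ 0 x+ 0 y+ (4 + 2 * i))
    (≤-by (4 + 2 * i) (solve (i ∷ []))) (≤-by 0 (solve (i ∷ [])))
    (≤-by (2 + 2 * k) (solve (i ∷ k ∷ []))) (≤-by (3 + 2 * k) (solve (i ∷ k ∷ [])))
  bot-lo-∦ _ top-bot = meets₁₂
  bot-lo-∦ _ up₀-bot = meets₁₂
  bot-lo-∦ {i} hi top-lo-last with gap hi
  ... | zero , refl = meets₂₂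
  ... | suc r , refl = swap (separates (0 x+ 0 y+ (4 + 2 * i + 2 * r) ≼ 1 x+ 0 y+ 0)
    (≤-by 0 (solve (i ∷ r ∷ []))) (≤-by 0 (solve (i ∷ r ∷ [])))
    (≤-by (3 + 2 * i + 2 * r) (solve (i ∷ r ∷ []))) (≤-by (1 + 2 * r) (solve (i ∷ r ∷ []))))

  up-up-∦ : ∀ {i c d} → i < q → Edge c d → NoCrossing (up i) (up (suc i)) c d
  up-up-∦ hi (top-up hj) = swap (top-up-∦ hj (up-up hi))
  up-up-∦ hi (bot-lo hj) = swap (bot-lo-∦ hj (up-up hi))
  up-up-∦ {i} _ (up-up {j} _) with cmp i j
  ... | less _ zero = meets₂₁
  ... | less _ (suc k) = swap (separates (0 x+ 0 y+ (5 + 2 * i + 2 * k) ≼ 1 x+ 0 y+ 0)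
    (≤-by 0 (solve (i ∷ k ∷ []))) (≤-by 2 (solve (i ∷ k ∷ [])))
    (≤-by (3 + 2 * k) (solve (i ∷ k ∷ []))) (≤-by (1 + 2 * k) (solve (i ∷ k ∷ []))))
  ... | equal _ = meets₁₁
  ... | greater _ zero = meets₁₂
  ... | greater _ (suc k) = separates (0 x+ 0 y+ (5 + 2 * j + 2 * k) ≼ 1 x+ 0 y+ 0)
    (≤-by 0 (solve (j ∷ k ∷ []))) (≤-by 2 (solve (j ∷ k ∷ [])))
    (≤-by (3 + 2 * k) (solve (j ∷ k ∷ []))) (≤-by (1 + 2 * k) (solve (j ∷ k ∷ [])))
  up-up-∦ {i} _ (lo-lo {j} _) = separates (0 x+ 0 y+ 2 ≼ 0 x+ 1 y+ 0)
    (≤-by 0 (solve (i ∷ []))) (≤-by 0 (solve (i ∷ [])))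
    (≤-by 0 (solve (j ∷ []))) (≤-by 0 (solve (j ∷ [])))
  up-up-∦ {i} _ (up-lo {j} _) with cmp j i
  ... | less _ k = separates (0 x+ 0 y+ (3 + 2 * j + 2 * k) ≼ 1 x+ 0 y+ 0)
    (≤-by 0 (solve (j ∷ k ∷ []))) (≤-by 2 (solve (j ∷ k ∷ [])))
    (≤-by (1 + 2 * k) (solve (j ∷ k ∷ []))) (≤-by (2 * k) (solve (j ∷ k ∷ [])))
  ... | equal _ = meets₁₁
  ... | greater _ zero = meets₂₁
  ... | greater _ (suc k) = swap (separates (0 x+ 0 y+ (5 + 2 * i + 2 * k) ≼ 1 x+ 0 y+ 0)
    (≤-by 0 (solve (i ∷ k ∷ []))) (≤-by 1 (solve (i ∷ k ∷ [])))
    (≤-by (3 + 2 * k) (solve (i ∷ k ∷ []))) (≤-by (1 + 2 * k) (solve (i ∷ k ∷ []))))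
  up-up-∦ {i} _ (up-lo⁺ {j} _) with cmp j i
  ... | less _ k = separates (0 x+ 0 y+ (9 + 2 * j + 2 * k) ≼ 1 x+ 3 y+ 0)
    (≤-by 0 (solve (j ∷ k ∷ []))) (≤-by 2 (solve (j ∷ k ∷ [])))
    (≤-by (1 + 2 * k) (solve (j ∷ k ∷ []))) (≤-by (1 + 2 * k) (solve (j ∷ k ∷ [])))
  ... | equal _ = meets₁₁
  ... | greater _ zero = meets₂₁
  ... | greater _ (suc k) = swap (separates (0 x+ 0 y+ (5 + 2 * i + 2 * k) ≼ 1 x+ 0 y+ 0)
    (≤-by 0 (solve (i ∷ k ∷ []))) (≤-by 3 (solve (i ∷ k ∷ [])))
    (≤-by (3 + 2 * k) (solve (i ∷ k ∷ []))) (≤-by (1 + 2 * k) (solve (i ∷ k ∷ []))))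
  up-up-∦ {i} _ top-bot = swap (separates ((5 + 4 * q) x+ 0 y+ 0 ≼ 0 x+ (2 + 2 * q) y+ 0)
    (≤-by 0 (solve (q ∷ []))) (≤-by 0 (solve (q ∷ [])))
    (≤-by (10 * i + 8 * i * q) (solve (i ∷ q ∷ []))) (≤-by (10 + 10 * i + 8 * q + 8 * i * q) (solve (i ∷ q ∷ []))))
  up-up-∦ {zero} _ up₀-bot = meets₁₁
  up-up-∦ {suc i} _ up₀-bot = separates (0 x+ 0 y+ 2 ≼ 1 x+ 0 y+ 0)
    (≤-by (1 + 2 * i) (solve (i ∷ []))) (≤-by (3 + 2 * i) (solve (i ∷ [])))
    (≤-by 0 refl) (≤-by 1 refl)
  up-up-∦ {i} hi top-lo-last with gap hi
  ... | r , refl = swap (separates (0 x+ 0 y+ (4 + 2 * i + 2 * r) ≼ 1 x+ 0 y+ 0)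
    (≤-by 0 (solve (i ∷ r ∷ []))) (≤-by 0 (solve (i ∷ r ∷ [])))
    (≤-by (2 + 2 * r) (solve (i ∷ r ∷ []))) (≤-by (2 * r) (solve (i ∷ r ∷ []))))

  lo-lo-∦ : ∀ {i c d} → i < q → Edge c d → NoCrossing (lo i) (lo (suc i)) c d
  lo-lo-∦ hi (top-up hj) = swap (top-up-∦ hj (lo-lo hi))
  lo-lo-∦ hi (bot-lo hj) = swap (bot-lo-∦ hj (lo-lo hi))
  lo-lo-∦ hi (up-up hj) = swap (up-up-∦ hj (lo-lo hi))
  lo-lo-∦ {i} _ (lo-lo {j} _) with cmp i j
  ... | less _ zero = meets₂₁
  ... | less _ (suc k) = swap (separates (0 x+ 0 y+ (6 + 2 * i + 2 * k) ≼ 1 x+ 0 y+ 0)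
    (≤-by 0 (solve (i ∷ k ∷ []))) (≤-by 2 (solve (i ∷ k ∷ [])))
    (≤-by (3 + 2 * k) (solve (i ∷ k ∷ []))) (≤-by (1 + 2 * k) (solve (i ∷ k ∷ []))))
  ... | equal _ = meets₁₁
  ... | greater _ zero = meets₁₂
  ... | greater _ (suc k) = separates (0 x+ 0 y+ (6 + 2 * j + 2 * k) ≼ 1 x+ 0 y+ 0)
    (≤-by 0 (solve (j ∷ k ∷ []))) (≤-by 2 (solve (j ∷ k ∷ [])))
    (≤-by (3 + 2 * k) (solve (j ∷ k ∷ []))) (≤-by (1 + 2 * k) (solve (j ∷ k ∷ [])))
  lo-lo-∦ {i} _ (up-lo {j} _) with cmp j i
  ... | less _ k = separates (0 x+ 0 y+ (4 + 2 * j + 2 * k) ≼ 1 x+ 0 y+ 0)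
    (≤-by 0 (solve (j ∷ k ∷ []))) (≤-by 2 (solve (j ∷ k ∷ [])))
    (≤-by (2 + 2 * k) (solve (j ∷ k ∷ []))) (≤-by (1 + 2 * k) (solve (j ∷ k ∷ [])))
  ... | equal _ = meets₁₂
  ... | greater _ zero = meets₂₂
  ... | greater _ (suc k) = swap (separates (0 x+ 0 y+ (5 + 2 * i + 2 * k) ≼ 1 x+ 0 y+ 0)
    (≤-by 0 (solve (i ∷ k ∷ []))) (≤-by 1 (solve (i ∷ k ∷ [])))
    (≤-by (2 + 2 * k) (solve (i ∷ k ∷ []))) (≤-by (2 * k) (solve (i ∷ k ∷ []))))
  lo-lo-∦ {i} _ (up-lo⁺ {j} _) with cmp j i
  ... | less _ zero = meets₁₂
  ... | less _ (suc k) = separates (0 x+ 0 y+ (9 + 2 * j + 2 * k) ≼ 1 x+ 3 y+ 0)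
    (≤-by 0 (solve (j ∷ k ∷ []))) (≤-by 2 (solve (j ∷ k ∷ [])))
    (≤-by (1 + 2 * k) (solve (j ∷ k ∷ []))) (≤-by (1 + 2 * k) (solve (j ∷ k ∷ [])))
  ... | equal _ = meets₂₂
  ... | greater _ k = swap (separates (0 x+ 0 y+ (8 + 2 * i) ≼ 1 x+ 3 y+ 0)
    (≤-by (1 + 2 * k) (solve (i ∷ k ∷ []))) (≤-by (1 + 2 * k) (solve (i ∷ k ∷ [])))
    (≤-by 2 (solve (i ∷ []))) (≤-by 0 (solve (i ∷ []))))
  lo-lo-∦ {i} _ top-bot = swap (separates ((5 + 4 * q) x+ 0 y+ 0 ≼ 0 x+ (2 + 2 * q) y+ 0)
    (≤-by 0 (solve (q ∷ []))) (≤-by 0 (solve (q ∷ [])))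
    (≤-by (7 + 10 * i + 6 * q + 8 * i * q) (solve (i ∷ q ∷ []))) (≤-by (17 + 10 * i + 14 * q + 8 * i * q) (solve (i ∷ q ∷ []))))
  lo-lo-∦ {i} _ up₀-bot = separates (0 x+ 0 y+ 2 ≼ 1 x+ 0 y+ 0)
    (≤-by (2 * i) (solve (i ∷ []))) (≤-by (2 + 2 * i) (solve (i ∷ [])))
    (≤-by 0 refl) (≤-by 1 refl)
  lo-lo-∦ {i} hi top-lo-last with gap hi
  ... | zero , refl = meets₂₂
  ... | suc r , refl = swap (separates (0 x+ 0 y+ (6 + 2 * i + 2 * r) ≼ 1 x+ 0 y+ 0)
    (≤-by 0 (solve (i ∷ r ∷ []))) (≤-by 0 (solve (i ∷ r ∷ [])))
    (≤-by (3 + 2 * r) (solve (i ∷ r ∷ []))) (≤-by (1 + 2 * r) (solve (i ∷ r ∷ []))))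

  up-lo-∦ : ∀ {i c d} → i ≤ q → Edge c d → NoCrossing (up i) (lo i) c d
  up-lo-∦ hi (top-up hj) = swap (top-up-∦ hj (up-lo hi))
  up-lo-∦ hi (bot-lo hj) = swap (bot-lo-∦ hj (up-lo hi))
  up-lo-∦ hi (up-up hj) = swap (up-up-∦ hj (up-lo hi))
  up-lo-∦ hi (lo-lo hj) = swap (lo-lo-∦ hj (up-lo hi))
  up-lo-∦ {i} _ (up-lo {j} _) with cmp i j
  ... | less _ k = swap (separates (0 x+ 0 y+ (3 + 2 * i + 2 * k) ≼ 1 x+ 0 y+ 0)
    (≤-by 0 (solve (i ∷ k ∷ []))) (≤-by 1 (solve (i ∷ k ∷ [])))
    (≤-by (1 + 2 * k) (solve (i ∷ k ∷ []))) (≤-by (2 * k) (solve (i ∷ k ∷ []))))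
  ... | equal _ = meets₁₁
  ... | greater _ k = separates (0 x+ 0 y+ (3 + 2 * j + 2 * k) ≼ 1 x+ 0 y+ 0)
    (≤-by 0 (solve (j ∷ k ∷ []))) (≤-by 1 (solve (j ∷ k ∷ [])))
    (≤-by (1 + 2 * k) (solve (j ∷ k ∷ []))) (≤-by (2 * k) (solve (j ∷ k ∷ [])))
  up-lo-∦ {i} _ (up-lo⁺ {j} _) with cmp j i
  ... | less _ zero = meets₂₂
  ... | less _ (suc k) = separates (0 x+ 0 y+ (5 + 2 * j + 2 * k) ≼ 1 x+ 0 y+ 0)
    (≤-by 0 (solve (j ∷ k ∷ []))) (≤-by 1 (solve (j ∷ k ∷ [])))
    (≤-by (3 + 2 * k) (solve (j ∷ k ∷ []))) (≤-by (2 * k) (solve (j ∷ k ∷ [])))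
  ... | equal _ = meets₁₁
  ... | greater _ k = swap (separates (0 x+ 0 y+ (3 + 2 * i + 2 * k) ≼ 1 x+ 0 y+ 0)
    (≤-by 0 (solve (i ∷ k ∷ []))) (≤-by 3 (solve (i ∷ k ∷ [])))
    (≤-by (1 + 2 * k) (solve (i ∷ k ∷ []))) (≤-by (2 * k) (solve (i ∷ k ∷ []))))
  up-lo-∦ {i} _ top-bot = swap (separates ((5 + 4 * q) x+ 0 y+ 0 ≼ 0 x+ (2 + 2 * q) y+ 0)
    (≤-by 0 (solve (q ∷ []))) (≤-by 0 (solve (q ∷ [])))
    (≤-by (10 * i + 8 * i * q) (solve (i ∷ q ∷ []))) (≤-by (7 + 10 * i + 6 * q + 8 * i * q) (solve (i ∷ q ∷ []))))
  up-lo-∦ {zero} _ up₀-bot = meets₁₁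
  up-lo-∦ {suc i} _ up₀-bot = separates (0 x+ 0 y+ 2 ≼ 1 x+ 0 y+ 0)
    (≤-by (1 + 2 * i) (solve (i ∷ []))) (≤-by (2 + 2 * i) (solve (i ∷ [])))
    (≤-by 0 refl) (≤-by 1 refl)
  up-lo-∦ {i} hi top-lo-last with gap hi
  ... | zero , refl = meets₂₂
  ... | suc r , refl = swap (separates (0 x+ 0 y+ (4 + 2 * i + 2 * r) ≼ 1 x+ 0 y+ 0)
    (≤-by 0 (solve (i ∷ r ∷ []))) (≤-by 0 (solve (i ∷ r ∷ [])))
    (≤-by (2 + 2 * r) (solve (i ∷ r ∷ []))) (≤-by (1 + 2 * r) (solve (i ∷ r ∷ []))))

  up-lo⁺-∦ : ∀ {i c d} → i < q → Edge c d → NoCrossing (up i) (lo (suc i)) c d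
  up-lo⁺-∦ hi (top-up hj) = swap (top-up-∦ hj (up-lo⁺ hi))
  up-lo⁺-∦ hi (bot-lo hj) = swap (bot-lo-∦ hj (up-lo⁺ hi))
  up-lo⁺-∦ hi (up-up hj) = swap (up-up-∦ hj (up-lo⁺ hi))
  up-lo⁺-∦ hi (lo-lo hj) = swap (lo-lo-∦ hj (up-lo⁺ hi))
  up-lo⁺-∦ hi (up-lo hj) = swap (up-lo-∦ hj (up-lo⁺ hi))
  up-lo⁺-∦ {i} _ (up-lo⁺ {j} _) with cmp i j
  ... | less _ k = swap (separates (0 x+ 0 y+ (8 + 2 * i) ≼ 1 x+ 3 y+ 0)
    (≤-by (1 + 2 * k) (solve (i ∷ k ∷ []))) (≤-by (1 + 2 * k) (solve (i ∷ k ∷ [])))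
    (≤-by 0 (solve (i ∷ []))) (≤-by 0 (solve (i ∷ []))))
  ... | equal _ = meets₁₁
  ... | greater _ k = separates (0 x+ 0 y+ (8 + 2 * j) ≼ 1 x+ 3 y+ 0)
    (≤-by (1 + 2 * k) (solve (j ∷ k ∷ []))) (≤-by (1 + 2 * k) (solve (j ∷ k ∷ [])))
    (≤-by 0 (solve (j ∷ []))) (≤-by 0 (solve (j ∷ [])))
  up-lo⁺-∦ {i} _ top-bot = swap (separates ((5 + 4 * q) x+ 0 y+ 0 ≼ 0 x+ (2 + 2 * q) y+ 0)
    (≤-by 0 (solve (q ∷ []))) (≤-by 0 (solve (q ∷ [])))
    (≤-by (10 * i + 8 * i * q) (solve (i ∷ q ∷ []))) (≤-by (17 + 10 * i + 14 * q + 8 * i * q) (solve (i ∷ q ∷ []))))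
  up-lo⁺-∦ {zero} _ up₀-bot = meets₁₁
  up-lo⁺-∦ {suc i} _ up₀-bot = separates (0 x+ 0 y+ 2 ≼ 1 x+ 0 y+ 0)
    (≤-by (1 + 2 * i) (solve (i ∷ []))) (≤-by (4 + 2 * i) (solve (i ∷ [])))
    (≤-by 0 refl) (≤-by 1 refl)
  up-lo⁺-∦ {i} hi top-lo-last with gap hi
  ... | zero , refl = meets₂₂
  ... | suc r , refl = swap (separates (0 x+ 0 y+ (6 + 2 * i + 2 * r) ≼ 1 x+ 0 y+ 0)
    (≤-by 0 (solve (i ∷ r ∷ []))) (≤-by 0 (solve (i ∷ r ∷ [])))
    (≤-by (4 + 2 * r) (solve (i ∷ r ∷ []))) (≤-by (1 + 2 * r) (solve (i ∷ r ∷ []))))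

  top-bot-∦ : ∀ {c d} → Edge c d → NoCrossing top bot c d
  top-bot-∦ (top-up hj) = swap (top-up-∦ hj top-bot)
  top-bot-∦ (bot-lo hj) = swap (bot-lo-∦ hj top-bot)
  top-bot-∦ (up-up hj) = swap (up-up-∦ hj top-bot)
  top-bot-∦ (lo-lo hj) = swap (lo-lo-∦ hj top-bot)
  top-bot-∦ (up-lo hj) = swap (up-lo-∦ hj top-bot)
  top-bot-∦ (up-lo⁺ hj) = swap (up-lo⁺-∦ hj top-bot)
  top-bot-∦ top-bot = meets₁₁
  top-bot-∦ up₀-bot = meets₂₂
  top-bot-∦ top-lo-last = meets₁₁

  up₀-bot-∦ : ∀ {c d} → Edge c d → NoCrossing (up 0) bot c d
  up₀-bot-∦ (top-up hj) = swap (top-up-∦ hj up₀-bot)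
  up₀-bot-∦ (bot-lo hj) = swap (bot-lo-∦ hj up₀-bot)
  up₀-bot-∦ (up-up hj) = swap (up-up-∦ hj up₀-bot)
  up₀-bot-∦ (lo-lo hj) = swap (lo-lo-∦ hj up₀-bot)
  up₀-bot-∦ (up-lo hj) = swap (up-lo-∦ hj up₀-bot)
  up₀-bot-∦ (up-lo⁺ hj) = swap (up-lo⁺-∦ hj up₀-bot)
  up₀-bot-∦ top-bot = swap (top-bot-∦ up₀-bot)
  up₀-bot-∦ up₀-bot = meets₁₁
  up₀-bot-∦ top-lo-last = swap (separates (0 x+ 0 y+ 2 ≼ 1 x+ 0 y+ 0)
    (≤-by (2 * q) (solve (q ∷ []))) (≤-by (2 * q) (solve (q ∷ [])))
    (≤-by 0 refl) (≤-by 1 refl))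

  top-lo-last-∦ : ∀ {c d} → Edge c d → NoCrossing top (lo q) c d
  top-lo-last-∦ (top-up hj) = swap (top-up-∦ hj top-lo-last)
  top-lo-last-∦ (bot-lo hj) = swap (bot-lo-∦ hj top-lo-last)
  top-lo-last-∦ (up-up hj) = swap (up-up-∦ hj top-lo-last)
  top-lo-last-∦ (lo-lo hj) = swap (lo-lo-∦ hj top-lo-last)
  top-lo-last-∦ (up-lo hj) = swap (up-lo-∦ hj top-lo-last)
  top-lo-last-∦ (up-lo⁺ hj) = swap (up-lo⁺-∦ hj top-lo-last)
  top-lo-last-∦ top-bot = swap (top-bot-∦ top-lo-last)
  top-lo-last-∦ up₀-bot = swap (up₀-bot-∦ top-lo-last)
  top-lo-last-∦ top-lo-last = meets₁₁

  top-up-∌ : ∀ {i w} → i ≤ q → InRange w → w ≢ top → w ≢ up i → NotOnSegment top (up i) w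
  top-up-∌ {w = top} _ _ w≢top _ = contradiction refl w≢top
  top-up-∌ {i} {bot} _ _ _ _ = excludes (0 x+ 0 y+ 2 ≼ 0 x+ 1 y+ 0)
    (≤-by (3 + 4 * q) (solve (q ∷ []))) (≤-by 0 (solve (i ∷ [])))
    (≤-by 1 refl)
  top-up-∌ {i} {lo j} _ _ _ _ = excludes (0 x+ 0 y+ 2 ≼ 0 x+ 1 y+ 0)
    (≤-by (3 + 4 * q) (solve (q ∷ []))) (≤-by 0 (solve (i ∷ [])))
    (≤-by 0 (solve (j ∷ [])))
  top-up-∌ {i} {up j} hi _ _ w≢up with cmp j i
  ... | equal _ = contradiction refl w≢up
  ... | greater _ k = excludes (1 x+ 0 y+ 4 ≼ 0 x+ 2 y+ (1 + 2 * i))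
    (≤-by (5 + 2 * i + 6 * q) (solve (i ∷ q ∷ []))) (≤-by 0 (solve (i ∷ [])))
    (≤-by (1 + 2 * k) (solve (i ∷ k ∷ [])))
  ... | less _ k with gap hi
  ...   | r , refl = excludes (0 x+ 0 y+ (7 + 2 * j + 2 * k) ≼ 1 x+ 2 y+ 0)
      (≤-by (15 + 8 * j + 8 * k + 10 * r) (solve (j ∷ k ∷ r ∷ []))) (≤-by 0 (solve (j ∷ k ∷ [])))
      (≤-by (1 + 2 * k) (solve (j ∷ k ∷ [])))

  bot-lo-∌ : ∀ {i w} → i ≤ q → InRange w → w ≢ bot → w ≢ lo i → NotOnSegment bot (lo i) w
  bot-lo-∌ {i} {top} _ _ _ _ = excludes (0 x+ 1 y+ 0 ≼ 0 x+ 0 y+ 1)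
    (≤-by 1 refl) (≤-by 0 (solve (i ∷ [])))
    (≤-by (3 + 4 * q) (solve (q ∷ [])))
  bot-lo-∌ {w = bot} _ _ w≢bot _ = contradiction refl w≢bot
  bot-lo-∌ {i} {up j} _ _ _ _ = excludes (0 x+ 1 y+ 0 ≼ 0 x+ 0 y+ 1)
    (≤-by 1 refl) (≤-by 0 (solve (i ∷ [])))
    (≤-by 0 (solve (j ∷ [])))
  bot-lo-∌ {i} {lo j} _ _ _ w≢lo with cmp j i
  ... | less _ k = excludes (0 x+ (4 + 2 * j + 2 * k) y+ 0 ≼ 1 x+ 0 y+ 0)
    (≤-by 0 (solve (j ∷ k ∷ []))) (≤-by 0 (solve (j ∷ k ∷ [])))
    (≤-by (1 + 2 * k) (solve (j ∷ k ∷ [])))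
  ... | equal _ = contradiction refl w≢lo
  ... | greater _ k = excludes (1 x+ 2 y+ 0 ≼ 0 x+ 0 y+ (4 + 2 * i))
    (≤-by (4 + 2 * i) (solve (i ∷ []))) (≤-by 0 (solve (i ∷ [])))
    (≤-by (1 + 2 * k) (solve (i ∷ k ∷ [])))

  up-up-∌ : ∀ {i w} → i < q → InRange w → w ≢ up i → w ≢ up (suc i) → NotOnSegment (up i) (up (suc i)) w
  up-up-∌ {i} {top} _ _ _ _ = excludes (0 x+ 1 y+ 0 ≼ 0 x+ 0 y+ 2)
    (≤-by 0 (solve (i ∷ []))) (≤-by 0 (solve (i ∷ [])))
    (≤-by (2 + 4 * q) (solve (q ∷ [])))
  up-up-∌ {i} {bot} _ _ _ _ = excludes (0 x+ 0 y+ 2 ≼ 0 x+ 1 y+ 0)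
    (≤-by 0 (solve (i ∷ []))) (≤-by 0 (solve (i ∷ [])))
    (≤-by 1 refl)
  up-up-∌ {i} {lo j} _ _ _ _ = excludes (0 x+ 0 y+ 2 ≼ 0 x+ 1 y+ 0)
    (≤-by 0 (solve (i ∷ []))) (≤-by 0 (solve (i ∷ [])))
    (≤-by 0 (solve (j ∷ [])))
  up-up-∌ {i} {up j} _ _ w≢up w≢up⁺ with cmp j i
  ... | less _ k = excludes (0 x+ 0 y+ (3 + 2 * j + 2 * k) ≼ 1 x+ 0 y+ 0)
    (≤-by 0 (solve (j ∷ k ∷ []))) (≤-by 2 (solve (j ∷ k ∷ [])))
    (≤-by (1 + 2 * k) (solve (j ∷ k ∷ [])))
  ... | equal _ = contradiction refl w≢up
  ... | greater _ zero = contradiction refl w≢up⁺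
  ... | greater _ (suc k) = excludes (1 x+ 0 y+ 0 ≼ 0 x+ 0 y+ (3 + 2 * i))
    (≤-by 2 (solve (i ∷ []))) (≤-by 0 (solve (i ∷ [])))
    (≤-by (1 + 2 * k) (solve (i ∷ k ∷ [])))

  lo-lo-∌ : ∀ {i w} → i < q → InRange w → w ≢ lo i → w ≢ lo (suc i) → NotOnSegment (lo i) (lo (suc i)) w
  lo-lo-∌ {i} {top} _ _ _ _ = excludes (0 x+ 1 y+ 0 ≼ 0 x+ 0 y+ 1)
    (≤-by 0 (solve (i ∷ []))) (≤-by 0 (solve (i ∷ [])))
    (≤-by (3 + 4 * q) (solve (q ∷ [])))
  lo-lo-∌ {i} {bot} _ _ _ _ = excludes (0 x+ 0 y+ 1 ≼ 0 x+ 1 y+ 0)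
    (≤-by 0 (solve (i ∷ []))) (≤-by 0 (solve (i ∷ [])))
    (≤-by 0 refl)
  lo-lo-∌ {i} {up j} _ _ _ _ = excludes (0 x+ 1 y+ 0 ≼ 0 x+ 0 y+ 1)
    (≤-by 0 (solve (i ∷ []))) (≤-by 0 (solve (i ∷ [])))
    (≤-by 0 (solve (j ∷ [])))
  lo-lo-∌ {i} {lo j} _ _ w≢lo w≢lo⁺ with cmp j i
  ... | less _ k = excludes (0 x+ 0 y+ (4 + 2 * j + 2 * k) ≼ 1 x+ 0 y+ 0)
    (≤-by 0 (solve (j ∷ k ∷ []))) (≤-by 2 (solve (j ∷ k ∷ [])))
    (≤-by (1 + 2 * k) (solve (j ∷ k ∷ [])))
  ... | equal _ = contradiction refl w≢lo
  ... | greater _ zero = contradiction refl w≢lo⁺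
  ... | greater _ (suc k) = excludes (1 x+ 0 y+ 0 ≼ 0 x+ 0 y+ (4 + 2 * i))
    (≤-by 2 (solve (i ∷ []))) (≤-by 0 (solve (i ∷ [])))
    (≤-by (1 + 2 * k) (solve (i ∷ k ∷ [])))

  up-lo-∌ : ∀ {i w} → i ≤ q → InRange w → w ≢ up i → w ≢ lo i → NotOnSegment (up i) (lo i) w
  up-lo-∌ {i} {top} _ _ _ _ = excludes (0 x+ 1 y+ 0 ≼ 0 x+ 0 y+ 2)
    (≤-by 0 (solve (i ∷ []))) (≤-by 1 (solve (i ∷ [])))
    (≤-by (2 + 4 * q) (solve (q ∷ [])))
  up-lo-∌ {i} {bot} _ _ _ _ = excludes (0 x+ 0 y+ 1 ≼ 0 x+ 1 y+ 0)
    (≤-by 1 (solve (i ∷ []))) (≤-by 0 (solve (i ∷ [])))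
    (≤-by 0 refl)
  up-lo-∌ {i} {up j} _ _ w≢up _ with cmp j i
  ... | less _ k = excludes (0 x+ 0 y+ (3 + 2 * j + 2 * k) ≼ 1 x+ 0 y+ 0)
    (≤-by 0 (solve (j ∷ k ∷ []))) (≤-by 1 (solve (j ∷ k ∷ [])))
    (≤-by (1 + 2 * k) (solve (j ∷ k ∷ [])))
  ... | equal _ = contradiction refl w≢up
  ... | greater _ k = excludes (1 x+ 0 y+ 0 ≼ 0 x+ 0 y+ (2 + 2 * i))
    (≤-by 1 (solve (i ∷ []))) (≤-by 0 (solve (i ∷ [])))
    (≤-by (2 * k) (solve (i ∷ k ∷ [])))
  up-lo-∌ {i} {lo j} _ _ _ w≢lo with cmp j i
  ... | less _ k = excludes (0 x+ 0 y+ (3 + 2 * j + 2 * k) ≼ 1 x+ 0 y+ 0)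
    (≤-by 0 (solve (j ∷ k ∷ []))) (≤-by 1 (solve (j ∷ k ∷ [])))
    (≤-by (2 * k) (solve (j ∷ k ∷ [])))
  ... | equal _ = contradiction refl w≢lo
  ... | greater _ k = excludes (1 x+ 0 y+ 0 ≼ 0 x+ 0 y+ (2 + 2 * i))
    (≤-by 1 (solve (i ∷ []))) (≤-by 0 (solve (i ∷ [])))
    (≤-by (1 + 2 * k) (solve (i ∷ k ∷ [])))

  up-lo⁺-∌ : ∀ {i w} → i < q → InRange w → w ≢ up i → w ≢ lo (suc i) → NotOnSegment (up i) (lo (suc i)) w
  up-lo⁺-∌ {i} {top} _ _ _ _ = excludes (0 x+ 1 y+ 0 ≼ 0 x+ 0 y+ 2)
    (≤-by 0 (solve (i ∷ []))) (≤-by 1 (solve (i ∷ [])))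
    (≤-by (2 + 4 * q) (solve (q ∷ [])))
  up-lo⁺-∌ {i} {bot} _ _ _ _ = excludes (0 x+ 0 y+ 1 ≼ 0 x+ 1 y+ 0)
    (≤-by 1 (solve (i ∷ []))) (≤-by 0 (solve (i ∷ [])))
    (≤-by 0 refl)
  up-lo⁺-∌ {i} {up j} _ _ w≢up _ with cmp j i
  ... | less _ k = excludes (0 x+ 0 y+ (3 + 2 * j + 2 * k) ≼ 1 x+ 0 y+ 0)
    (≤-by 0 (solve (j ∷ k ∷ []))) (≤-by 3 (solve (j ∷ k ∷ [])))
    (≤-by (1 + 2 * k) (solve (j ∷ k ∷ [])))
  ... | equal _ = contradiction refl w≢up
  ... | greater _ k = excludes (1 x+ 3 y+ 0 ≼ 0 x+ 0 y+ (7 + 2 * i))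
    (≤-by 0 (solve (i ∷ []))) (≤-by 0 (solve (i ∷ [])))
    (≤-by (1 + 2 * k) (solve (i ∷ k ∷ [])))
  up-lo⁺-∌ {i} {lo j} _ _ _ w≢lo⁺ with cmp j (suc i)
  ... | less _ k = excludes (0 x+ 0 y+ (7 + 2 * j + 2 * k) ≼ 1 x+ 3 y+ 0)
    (≤-by 0 (solve (j ∷ k ∷ []))) (≤-by 0 (solve (j ∷ k ∷ [])))
    (≤-by (1 + 2 * k) (solve (j ∷ k ∷ [])))
  ... | equal _ = contradiction refl w≢lo⁺
  ... | greater _ k = excludes (1 x+ 3 y+ 0 ≼ 0 x+ 0 y+ (7 + 2 * i))
    (≤-by 0 (solve (i ∷ []))) (≤-by 0 (solve (i ∷ [])))
    (≤-by (1 + 2 * k) (solve (i ∷ k ∷ [])))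

  top-bot-∌ : ∀ {w} → InRange w → w ≢ top → w ≢ bot → NotOnSegment top bot w
  top-bot-∌ {top} _ w≢top _ = contradiction refl w≢top
  top-bot-∌ {bot} _ _ w≢bot = contradiction refl w≢bot
  top-bot-∌ {up j} _ _ _ = excludes ((5 + 4 * q) x+ 0 y+ 0 ≼ 0 x+ (2 + 2 * q) y+ 0)
    (≤-by 0 (solve (q ∷ []))) (≤-by 0 (solve (q ∷ [])))
    (≤-by (10 * j + 8 * j * q) (solve (j ∷ q ∷ [])))
  top-bot-∌ {lo j} _ _ _ = excludes ((5 + 4 * q) x+ 0 y+ 0 ≼ 0 x+ (2 + 2 * q) y+ 0)
    (≤-by 0 (solve (q ∷ []))) (≤-by 0 (solve (q ∷ [])))
    (≤-by (7 + 10 * j + 6 * q + 8 * j * q) (solve (j ∷ q ∷ [])))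

  up₀-bot-∌ : ∀ {w} → InRange w → w ≢ up 0 → w ≢ bot → NotOnSegment (up 0) bot w
  up₀-bot-∌ {top} _ _ _ = excludes (0 x+ 1 y+ 0 ≼ 0 x+ 0 y+ 2)
    (≤-by 0 refl) (≤-by 2 refl)
    (≤-by (2 + 4 * q) (solve (q ∷ [])))
  up₀-bot-∌ {bot} _ _ w≢bot = contradiction refl w≢bot
  up₀-bot-∌ {up zero} _ w≢up₀ _ = contradiction refl w≢up₀
  up₀-bot-∌ {up (suc j)} _ _ _ = excludes (1 x+ 0 y+ 0 ≼ 0 x+ 0 y+ 1)
    (≤-by 0 refl) (≤-by 1 refl)
    (≤-by (1 + 2 * j) (solve (j ∷ [])))
  up₀-bot-∌ {lo j} _ _ _ = excludes (1 x+ 0 y+ 0 ≼ 0 x+ 0 y+ 1)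
    (≤-by 0 refl) (≤-by 1 refl)
    (≤-by (2 * j) (solve (j ∷ [])))

  top-lo-last-∌ : ∀ {w} → InRange w → w ≢ top → w ≢ lo q → NotOnSegment top (lo q) w
  top-lo-last-∌ {top} _ w≢top _ = contradiction refl w≢top
  top-lo-last-∌ {bot} _ _ _ = excludes (0 x+ 0 y+ (2 + 2 * q) ≼ 1 x+ 0 y+ 0)
    (≤-by 0 (solve (q ∷ []))) (≤-by 0 (solve (q ∷ [])))
    (≤-by (1 + 2 * q) (solve (q ∷ [])))
  top-lo-last-∌ {up j} hj _ _ with gap hj
  ... | r , refl = excludes (0 x+ 0 y+ (2 + 2 * j + 2 * r) ≼ 1 x+ 0 y+ 0)
    (≤-by 0 (solve (j ∷ r ∷ []))) (≤-by 0 (solve (j ∷ r ∷ [])))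
    (≤-by (2 * r) (solve (j ∷ r ∷ [])))
  top-lo-last-∌ {lo j} hj _ w≢lo-last with gap hj
  ... | zero , refl = contradiction refl w≢lo-last
  ... | suc r , refl = excludes (0 x+ 0 y+ (4 + 2 * j + 2 * r) ≼ 1 x+ 0 y+ 0)
    (≤-by 0 (solve (j ∷ r ∷ []))) (≤-by 0 (solve (j ∷ r ∷ [])))
    (≤-by (1 + 2 * r) (solve (j ∷ r ∷ [])))

  noCrossing : ∀ {a b c d} → Edge a b → Edge c d → NoCrossing a b c d
  noCrossing (top-up hi)  = top-up-∦ hi
  noCrossing (bot-lo hi)  = bot-lo-∦ hi
  noCrossing (up-up hi)   = up-up-∦ hi
  noCrossing (lo-lo hi)   = lo-lo-∦ hi
  noCrossing (up-lo hi)   = up-lo-∦ hi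
  noCrossing (up-lo⁺ hi)  = up-lo⁺-∦ hi
  noCrossing top-bot      = top-bot-∦
  noCrossing up₀-bot      = up₀-bot-∦
  noCrossing top-lo-last  = top-lo-last-∦

  notOnSegment : ∀ {a b w} → Edge a b → InRange w → w ≢ a → w ≢ b → NotOnSegment a b w
  notOnSegment (top-up hi)  = top-up-∌ hi
  notOnSegment (bot-lo hi)  = bot-lo-∌ hi
  notOnSegment (up-up hi)   = up-up-∌ hi
  notOnSegment (lo-lo hi)   = lo-lo-∌ hi
  notOnSegment (up-lo hi)   = up-lo-∌ hi
  notOnSegment (up-lo⁺ hi)  = up-lo⁺-∌ hi
  notOnSegment top-bot      = top-bot-∌
  notOnSegment up₀-bot      = up₀-bot-∌
  notOnSegment top-lo-last  = top-lo-last-∌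

  edge? : ∀ u v → Dec (Edge u v)
  edge? top    (up i) = map′ top-up (λ { (top-up h) → h }) (i ≤? q)
  edge? bot    (lo i) = map′ bot-lo (λ { (bot-lo h) → h }) (i ≤? q)
  edge? top    bot    = yes top-bot
  edge? (up i) (up j) with j ≟ suc i
  ... | yes refl = map′ up-up (λ { (up-up h) → h }) (suc i ≤? q)
  ... | no j≢1+i = no λ { (up-up _) → j≢1+i refl }
  edge? (lo i) (lo j) with j ≟ suc i
  ... | yes refl = map′ lo-lo (λ { (lo-lo h) → h }) (suc i ≤? q)
  ... | no j≢1+i = no λ { (lo-lo _) → j≢1+i refl }
  edge? (up i) (lo j) with j ≟ i | j ≟ suc i
  ... | yes refl | _        = map′ up-lo (λ { (up-lo h) → h }) (i ≤? q)
  ... | no _     | yes refl = map′ up-lo⁺ (λ { (up-lo⁺ h) → h }) (suc i ≤? q)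
  ... | no j≢i   | no j≢1+i = no λ { (up-lo _) → j≢i refl ; (up-lo⁺ _) → j≢1+i refl }
  edge? (up i) bot with i ≟ 0
  ... | yes refl = yes up₀-bot
  ... | no i≢0   = no λ { up₀-bot → i≢0 refl }
  edge? top    (lo i) with i ≟ q
  ... | yes refl = yes top-lo-last
  ... | no i≢q   = no λ { top-lo-last → i≢q refl }
  edge? top    top    = no λ ()
  edge? bot    top    = no λ ()
  edge? bot    bot    = no λ ()
  edge? bot    (up _) = no λ ()
  edge? (up _) top    = no λ ()
  edge? (lo _) top    = no λ ()
  edge? (lo _) bot    = no λ ()
  edge? (lo _) (up _) = no λ ()

  Adjacent : Vertex → Vertex → Set
  Adjacent u v = Edge u v ⊎ Edge v u

  adjacent : Vertex → Vertex → Bool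
  adjacent u v = does (edge? u v ⊎-dec edge? v u)

  adjacent-sym : ∀ u v → adjacent u v ≡ adjacent v u
  adjacent-sym u v = ∨-comm (does (edge? u v)) (does (edge? v u))

  adjacent-irrefl : ∀ v → adjacent v v ≡ false
  adjacent-irrefl v = dec-false (edge? v v ⊎-dec edge? v v) λ { (inj₁ ()) ; (inj₂ ()) }

  adjacent⇒Adjacent : ∀ u v → adjacent u v ≡ true → Adjacent u v
  adjacent⇒Adjacent u v = does⇒ (edge? u v ⊎-dec edge? v u)

  Adjacent⇒𝟙≡1 : ∀ {u v} → Adjacent u v → 𝟙 (adjacent u v) ≡ 1
  Adjacent⇒𝟙≡1 {u} {v} uv = cong 𝟙 (dec-true (edge? u v ⊎-dec edge? v u) uv)

  order : ℕ
  order = 4 + double q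

  graph : Graph order
  graph = record
    { adj    = λ u v → adjacent (vertex (toℕ u)) (vertex (toℕ v))
    ; sym    = λ u v → adjacent-sym (vertex (toℕ u)) (vertex (toℕ v))
    ; irrefl = λ u → adjacent-irrefl (vertex (toℕ u))
    }

  index<order⇒InRange : ∀ v → index v < order → InRange v
  index<order⇒InRange top    _ = tt
  index<order⇒InRange bot    _ = tt
  index<order⇒InRange (up i) (s≤s (s≤s (s≤s i≤))) = double-≤-cancel i≤
  index<order⇒InRange (lo i) (s≤s (s≤s (s≤s (s≤s i≤)))) = double-≤-cancel (m≤n⇒m≤1+n i≤)

  position-injective : ∀ u v → position u ≡ position v → u ≡ v
  position-injective top    top    _  = refl
  position-injective bot    bot    _  = refl
  position-injective (up i) (up j) eq = cong up (*-cancelˡ-≡ i j 2 (suc-injective (ℤ.+-injective (cong proj₁ eq))))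
  position-injective (lo i) (lo j) eq =
    cong lo (*-cancelˡ-≡ i j 2 (suc-injective (suc-injective (ℤ.+-injective (cong proj₁ eq)))))
  position-injective top    bot    eq = contradiction (ℤ.+-injective (cong proj₂ eq)) λ ()
  position-injective top    (up _) eq = contradiction (ℤ.+-injective (cong proj₂ eq)) λ ()
  position-injective top    (lo _) eq = contradiction (ℤ.+-injective (cong proj₂ eq)) λ ()
  position-injective bot    top    eq = contradiction (ℤ.+-injective (cong proj₂ eq)) λ ()
  position-injective bot    (up _) eq = contradiction (ℤ.+-injective (cong proj₂ eq)) λ ()
  position-injective bot    (lo _) eq = contradiction (ℤ.+-injective (cong proj₂ eq)) λ ()
  position-injective (up _) top    eq = contradiction (ℤ.+-injective (cong proj₂ eq)) λ ()
  position-injective (up _) bot    eq = contradiction (ℤ.+-injective (cong proj₂ eq)) λ ()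
  position-injective (up _) (lo _) eq = contradiction (ℤ.+-injective (cong proj₂ eq)) λ ()
  position-injective (lo _) top    eq = contradiction (ℤ.+-injective (cong proj₂ eq)) λ ()
  position-injective (lo _) bot    eq = contradiction (ℤ.+-injective (cong proj₂ eq)) λ ()
  position-injective (lo _) (up _) eq = contradiction (ℤ.+-injective (cong proj₂ eq)) λ ()

  Adjacent⇒noCrossing : ∀ {a b c d} → Adjacent a b → Adjacent c d → NoCrossing a b c d
  Adjacent⇒noCrossing (inj₁ ab) (inj₁ cd) = noCrossing ab cd
  Adjacent⇒noCrossing (inj₂ ba) (inj₁ cd) = flip₁ (noCrossing ba cd)
  Adjacent⇒noCrossing (inj₁ ab) (inj₂ dc) = flip₂ (noCrossing ab dc)
  Adjacent⇒noCrossing (inj₂ ba) (inj₂ dc) = flip₁ (flip₂ (noCrossing ba dc))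

  decode-injective : ∀ {u v : Fin order} → vertex (toℕ u) ≡ vertex (toℕ v) → u ≡ v
  decode-injective = toℕ-injective ∘ vertex-injective

  decode-in-range : ∀ (u : Fin order) → InRange (vertex (toℕ u))
  decode-in-range u = index<order⇒InRange (vertex (toℕ u))
    (subst (_< order) (sym (index-vertex (toℕ u))) (toℕ<n u))

  -- The drawing is given as a λ-term so that its applications are syntactically
  -- the positions used above: unfolding ProperCross to compare them is exponential.
  planar : Planar graph
  planar = (λ u → position (vertex (toℕ u))) , drawing-injective , no-vertex-on-edge , no-crossing
    where
    drawing-injective : ∀ {u v : Fin order} → position (vertex (toℕ u)) ≡ position (vertex (toℕ v)) → u ≡ v
    drawing-injective {u} {v} eq = decode-injective (position-injective (vertex (toℕ u)) (vertex (toℕ v)) eq)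

    no-vertex-on-edge : ∀ u v w → adj graph u v ≡ true → w ≢ u → w ≢ v →
      ¬ OnSegment (position (vertex (toℕ u))) (position (vertex (toℕ v))) (position (vertex (toℕ w)))
    no-vertex-on-edge u v w uv w≢u w≢v with adjacent⇒Adjacent (vertex (toℕ u)) (vertex (toℕ v)) uv
    ... | inj₁ e = ¬onSegment (notOnSegment e (decode-in-range w) (w≢u ∘ decode-injective) (w≢v ∘ decode-injective))
    ... | inj₂ e = ¬OnSegment-flip {position (vertex (toℕ v))} {position (vertex (toℕ u))} {position (vertex (toℕ w))}
      (¬onSegment (notOnSegment e (decode-in-range w) (w≢v ∘ decode-injective) (w≢u ∘ decode-injective)))

    no-crossing : ∀ a b c d → adj graph a b ≡ true → adj graph c d ≡ true →
      ¬ ProperCross (position (vertex (toℕ a))) (position (vertex (toℕ b)))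
                    (position (vertex (toℕ c))) (position (vertex (toℕ d)))
    no-crossing a b c d ab cd = ¬properCross (Adjacent⇒noCrossing
      (adjacent⇒Adjacent (vertex (toℕ a)) (vertex (toℕ b)) ab) (adjacent⇒Adjacent (vertex (toℕ c)) (vertex (toℕ d)) cd))

  deg : Vertex → ℕ
  deg w = ∑< order (λ x → 𝟙 (adjacent (vertex x) w))

  neighbours-in : Vertex → ℕ → ℕ
  neighbours-in w t = 𝟙 (adjacent (up t) w) + 𝟙 (adjacent (lo t) w)

  deg-≥ : ∀ w {a b c} → a ≤ 𝟙 (adjacent top w) → b ≤ 𝟙 (adjacent bot w) →
          c ≤ ∑< (suc q) (neighbours-in w) → a + (b + c) ≤ deg w
  deg-≥ w {a} {b} {c} a≤ b≤ c≤ = subst (a + (b + c) ≤_) (sym (∑<-vertices (suc q) (λ v → 𝟙 (adjacent v w))))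
    (+-mono-≤ a≤ (+-mono-≤ b≤ c≤))

  counts : ∀ {u v} → Adjacent u v → 1 ≤ 𝟙 (adjacent u v)
  counts uv = ≤-reflexive (sym (Adjacent⇒𝟙≡1 uv))

  up-in : ∀ {w t} → Adjacent (up t) w → 1 ≤ neighbours-in w t
  up-in up~w = ≤-trans (counts up~w) (m≤m+n _ _)

  lo-in : ∀ {w t} → Adjacent (lo t) w → 1 ≤ neighbours-in w t
  lo-in lo~w = ≤-trans (counts lo~w) (m≤n+m _ _)

  two-in : ∀ {w t} → Adjacent (up t) w → Adjacent (lo t) w → 2 ≤ neighbours-in w t
  two-in up~w lo~w = +-mono-≤ (counts up~w) (counts lo~w)

  top-degree : 3 + q ≤ deg top
  top-degree = deg-≥ top z≤n (counts (inj₂ top-bot)) (begin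
    2 + q                                           ≡⟨ cong (2 +_) (*-identityʳ q) ⟨
    2 + q * 1                                       ≡⟨ +-comm 2 (q * 1) ⟩
    q * 1 + 2                                       ≤⟨ +-mono-≤ (∑<-lower q λ t t<q → up-in (inj₂ (top-up (<⇒≤ t<q))))
                                                                (two-in (inj₂ (top-up ≤-refl)) (inj₂ top-lo-last)) ⟩
    ∑< q (neighbours-in top) + neighbours-in top q  ≡⟨ ∑<-last q (neighbours-in top) ⟨
    ∑< (suc q) (neighbours-in top)                  ∎)
    where open ≤-Reasoning

  bot-degree : 3 + q ≤ deg bot
  bot-degree = deg-≥ bot (counts (inj₁ top-bot)) z≤n (+-mono-≤ (two-in (inj₁ up₀-bot) (inj₂ (bot-lo z≤n)))
    (subst (_≤ ∑< q (neighbours-in bot ∘ suc)) (*-identityʳ q) (∑<-lower q λ t t<q → lo-in (inj₂ (bot-lo t<q)))))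

  up-degree : ∀ {j} → j < q → 5 ≤ deg (up j)
  up-degree {zero} 0<q = deg-≥ (up 0) (counts (inj₁ (top-up z≤n))) (counts (inj₂ up₀-bot)) (≤-trans
    (+-mono-≤ (lo-in (inj₂ (up-lo z≤n))) (+-mono-≤ (two-in (inj₂ (up-up 0<q)) (inj₂ (up-lo⁺ 0<q))) z≤n))
    (∑<-window 0 2 (suc q) (neighbours-in (up 0)) (s≤s 0<q)))
  up-degree {suc j} 1+j<q = deg-≥ (up (suc j)) (counts (inj₁ (top-up (<⇒≤ 1+j<q)))) z≤n (≤-trans
    (+-mono-≤ (up-in (inj₁ (up-up (<⇒≤ 1+j<q))))
      (+-mono-≤ (lo-in (inj₂ (up-lo (<⇒≤ 1+j<q))))
        (+-mono-≤ (two-in (inj₂ (up-up 1+j<q)) (inj₂ (up-lo⁺ 1+j<q))) z≤n)))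
    (∑<-window j 3 (suc q) (neighbours-in (up (suc j))) (subst (_≤ suc q) (+-comm 3 j) (s≤s 1+j<q))))

  up-degree-≥3 : ∀ {j} → j ≤ q → 3 ≤ deg (up j)
  up-degree-≥3 {zero} _ = deg-≥ (up 0) (counts (inj₁ (top-up z≤n))) (counts (inj₂ up₀-bot))
    (≤-trans (+-mono-≤ (lo-in (inj₂ (up-lo z≤n))) z≤n) (∑<-window 0 1 (suc q) (neighbours-in (up 0)) (s≤s z≤n)))
  up-degree-≥3 {suc j} j<q = deg-≥ (up (suc j)) (counts (inj₁ (top-up j<q))) z≤n (≤-trans
    (+-mono-≤ (up-in (inj₁ (up-up j<q))) (+-mono-≤ (lo-in (inj₂ (up-lo j<q))) z≤n))
    (∑<-window j 2 (suc q) (neighbours-in (up (suc j))) (subst (_≤ suc q) (+-comm 2 j) (s≤s j<q))))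

  lo₀-degree : 3 ≤ deg (lo 0)
  lo₀-degree with gap (z≤n {q})
  ... | zero  , refl = deg-≥ (lo 0) (counts (inj₁ top-lo-last)) (counts (inj₁ (bot-lo z≤n)))
    (≤-trans (+-mono-≤ (up-in (inj₁ (up-lo z≤n))) z≤n) (∑<-window 0 1 (suc q) (neighbours-in (lo 0)) (s≤s z≤n)))
  ... | suc r , refl = deg-≥ (lo 0) z≤n (counts (inj₁ (bot-lo z≤n))) (≤-trans
    (+-mono-≤ (up-in (inj₁ (up-lo z≤n))) (+-mono-≤ (lo-in (inj₂ (lo-lo (s≤s z≤n)))) z≤n))
    (∑<-window 0 2 (suc q) (neighbours-in (lo 0)) (s≤s (s≤s z≤n))))

  lo-degree : ∀ {j} → j < q → 5 ≤ deg (lo (suc j))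
  lo-degree {j} j<q with gap j<q
  ... | zero  , refl = deg-≥ (lo (suc j)) (counts (inj₁ top-lo-last)) (counts (inj₁ (bot-lo ≤-refl))) (≤-trans
    (+-mono-≤ (two-in (inj₁ (up-lo⁺ ≤-refl)) (inj₁ (lo-lo ≤-refl))) (+-mono-≤ (up-in (inj₁ (up-lo ≤-refl))) z≤n))
    (∑<-window j 2 (suc q) (neighbours-in (lo (suc j))) (≤-reflexive (+-comm j 2))))
  ... | suc r , refl = deg-≥ (lo (suc j)) z≤n (counts (inj₁ (bot-lo j<q))) (≤-trans
    (+-mono-≤ (two-in (inj₁ (up-lo⁺ j<q)) (inj₁ (lo-lo j<q)))
      (+-mono-≤ (up-in (inj₁ (up-lo j<q)))
        (+-mono-≤ (lo-in (inj₂ (lo-lo (s≤s (m≤n+m (suc j) r))))) z≤n)))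
    (∑<-window j 3 (suc q) (neighbours-in (lo (suc j))) (subst (_≤ suc q) (+-comm 3 j) (s≤s (s≤s (m≤n+m (suc j) r))))))

  degree≡deg : ∀ v → degree graph v ≡ deg (vertex (toℕ v))
  degree≡deg v = sum≡∑< order (λ x → 𝟙 (adjacent (vertex x) (vertex (toℕ v))))

  ⌈deg/2⌉-sum : ⌈ 3 + q /2⌉ + (⌈ 3 + q /2⌉ + (2 + q * 6 + 2)) ≤ ∑< order (λ x → ⌈ deg (vertex x) /2⌉)
  ⌈deg/2⌉-sum = begin
    ⌈ 3 + q /2⌉ + (⌈ 3 + q /2⌉ + (2 + q * 6 + 2))
      ≤⟨ +-mono-≤ (⌈n/2⌉-mono top-degree) (+-mono-≤ (⌈n/2⌉-mono bot-degree)
           (+-mono-≤ (+-mono-≤ (⌈n/2⌉-mono lo₀-degree) pairs) (⌈n/2⌉-mono (up-degree-≥3 ≤-refl)))) ⟩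
    h top + (h bot + (h (lo 0) + ∑< q (λ t → h (up t) + h (lo (suc t))) + h (up q)))
      ≡⟨ cong (λ s → h top + (h bot + s)) (∑<-pair-shift q (h ∘ up) (h ∘ lo)) ⟨
    h top + (h bot + ∑< (suc q) (λ t → h (up t) + h (lo t)))
      ≡⟨ ∑<-vertices (suc q) h ⟨
    ∑< order (h ∘ vertex)                       ∎
    where
    open ≤-Reasoning
    h : Vertex → ℕ
    h v = ⌈ deg v /2⌉
    pairs : q * 6 ≤ ∑< q (λ t → h (up t) + h (lo (suc t)))
    pairs = ∑<-lower q λ t t<q → +-mono-≤ (⌈n/2⌉-mono (up-degree t<q)) (⌈n/2⌉-mono (lo-degree t<q))

  inversions-needed : ∀ o → IsOrientation graph o → ∀ Xs → ConvSeq≤3 o Xs →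
                      ⌈ 3 + q /2⌉ + (⌈ 3 + q /2⌉ + (2 + q * 6 + 2)) ≤ 3 * length Xs
  inversions-needed o isOrientation Xs conv =
    ≤-trans ⌈deg/2⌉-sum (≤-trans (≤-reflexive (sym (trans (sum-cong-≗ λ v → cong ⌈_/2⌉ (degree≡deg v))
                                                       (sum≡∑< order (λ x → ⌈ deg (vertex x) /2⌉)))))
                              (∑⌈degree/2⌉≤3*length graph o isOrientation Xs conv))

-- With q = double k the half-degree bound is exactly (7 n - 12) / 2.
seven-order : ∀ k → 7 * (4 + double (double k)) ≡
  2 * (⌈ 3 + double k /2⌉ + (⌈ 3 + double k /2⌉ + (2 + double k * 6 + 2))) + 12
seven-order k = begin
  7 * (4 + double (double k))                              ≡⟨ cong (λ m → 7 * (4 + m)) (double-double k) ⟩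
  7 * (4 + k * 4)                                          ≡⟨ solve (k ∷ []) ⟩
  2 * ((2 + k) + ((2 + k) + (2 + (k + k) * 6 + 2))) + 12   ≡⟨ cong₂ (λ h d → 2 * (h + (h + (2 + d * 6 + 2))) + 12)
                                                                    (cong (2 +_) (⌊double/2⌋ k)) (double≡+ k) ⟨
  2 * (⌈ 3 + double k /2⌉ + (⌈ 3 + double k /2⌉ + (2 + double k * 6 + 2))) + 12 ∎
  where open ≡-Reasoning

corollary39 : ∀ (n : ℕ) → 0 < n → 4 ∣ n →
    Σ (Graph n) λ G → Planar G ×
      (∀ o → IsOrientation G o → ∀ Xs → ConvSeq≤3 o Xs →
        7 * n ≤ 6 * length Xs + 12)
corollary39 .(zero * 4)  ()  (divides zero    refl)
corollary39 .(suc k * 4) _   (divides (suc k) refl) =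
  subst Witness (cong (4 +_) (double-double k)) (graph , planar , bound)
  where
  open Construction (double k)
  Witness : ℕ → Set
  Witness n = Σ (Graph n) λ G → Planar G ×
    (∀ o → IsOrientation G o → ∀ Xs → ConvSeq≤3 o Xs → 7 * n ≤ 6 * length Xs + 12)
  bound : ∀ o → IsOrientation graph o → ∀ Xs → ConvSeq≤3 o Xs → 7 * order ≤ 6 * length Xs + 12
  bound o isOrientation Xs conv = begin
    7 * order                                 ≡⟨ seven-order k ⟩
    2 * (⌈ 3 + double k /2⌉ + (⌈ 3 + double k /2⌉ + (2 + double k * 6 + 2))) + 12
                                              ≤⟨ +-monoˡ-≤ 12 (*-monoʳ-≤ 2 (inversions-needed o isOrientation Xs conv)) ⟩
    2 * (3 * length Xs) + 12                  ≡⟨ cong (_+ 12) (*-assoc 2 3 (length Xs)) ⟨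
    6 * length Xs + 12                        ∎
    where open ≤-Reasoning
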